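{- Let $f$ be a polynomial of either of the following two types. Type A: $k>1$ odd, $\ell$ an integer with $k<\ell<\sqrt3k$, $\gcd(k,\ell)=1$, integers $u,v\ge0$ with $k^2u-\ell^2v=\pm1$, $g\in\{2,4\}$ (with $\ell$ odd if $g=4$), and $f(n)=\big(k^2(1+2n)+gv\big)\big(\ell^2(1+2n)+gu\big)$. Type B: $k,\ell$ even positive integers with $k<\ell<\sqrt3k$, $\gcd(k,\ell)=2$, exactly one of $k,\ell$ divisible by $4$, integers $u,v\ge0$ with $k^2u-\ell^2v=\pm4$, and $f(n)=d_1(n)d_2(n)$ where: if $u,v$ are odd and $u\equiv v\pmod4$, $d_1(n)=v+k^2(2n+1)$, $d_2(n)=u+\ell^2(2n+1)$; if $u,v$ are odd and $u\not\equiv v\pmod4$, $d_1(n)=v+k^2(2n+\tfrac12)$, $d_2(n)=u+\ell^2(2n+\tfrac12)$; if one of $u,v$ is even, with $u'$ the even one and $v'$ the other, then $d_1(n)=v+k^2(n+\tfrac14)$, $d_2(n)=u+\ell^2(n+\tfrac14)$ when $v'\equiv u'+1\pmod4$, and $d_1(n)=v+k^2(n+\tfrac34)$, $d_2(n)=u+\ell^2(n+\tfrac34)$ when $v'\equiv u'+3\pmod4$. Then, as $N\to\infty$, the number of positive integers $n\le N$ for which $f(n)$ is squarefree is asymptotic to $c_fN$, where \[ c_f=2\prod_{p\text{ prime}}\Big(1-\frac{2}{p^2}\Big)\prod_{p>2\text{ prime},\ p\mid k\ell}\frac{p^2-1}{p^2-2}. \] In particular $c_f>0.64$.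
   Context: In both types, $u,v$ are as produced by the extended Euclidean algorithm: $u=|g_0|,v=|h_0|$ for a solution of $k^2g_0+\ell^2h_0=1$ (Type A) or $=4$ (Type B). -}

module Defs where

open import Data.Nat as ℕ using (ℕ; zero; suc; _+_; _*_; _<_; _≤_; _<?_; NonZero; _%_)
import Data.Nat.Properties as ℕP
open import Data.Nat.Divisibility using (_∣_; _∣?_; ∣⇒≤; ∣-trans; divides; m∣m*n)
open import Data.Nat.Primality using (Prime; prime?; prime[2])
open import Data.Nat.GCD using (gcd)
open import Data.Integer using (+_)
open import Data.Rational as ℚ using (ℚ; 1ℚ)
open import Data.Product using (_×_; _,_)
open import Data.Sum using (_⊎_)
open import Relation.Nullary using (¬_; Dec; yes; no; does; _×-dec_)
open import Relation.Binary.PropositionalEquality using (_≡_; refl)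
open import Data.Bool using (if_then_else_)

SquareFree : ℕ → Set
SquareFree n = ∀ p → Prime p → ¬ (p * p ∣ n)

private
  p≤pp : ∀ {p n} → .{{NonZero n}} → p * p ∣ n → p ≤ n
  p≤pp {p} d = ∣⇒≤ (∣-trans (m∣m*n p) d)

squareFree? : (n : ℕ) → Dec (SquareFree n)
squareFree? zero = no (λ sf → sf 2 prime[2] (divides 0 refl))
squareFree? n@(suc m) with ℕP.allUpTo? (λ p → dec p) (suc n)
  where
  dec : ∀ p → Dec (Prime p → ¬ (p * p ∣ n))
  dec p with prime? p | p * p ∣? n
  ... | yes pp | yes d = no (λ f → f pp d)
  ... | no ¬pp | _     = yes (λ pp _ → ¬pp pp)
  ... | _      | no ¬d = yes (λ _ d → ¬d d)
... | yes all = yes (λ p pp d → all (ℕ.s≤s (p≤pp d)) pp d)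
... | no ¬all = no (λ sf → ¬all (λ {p} _ → sf p))

sqfreeCount : (ℕ → ℕ) → ℕ → ℕ
sqfreeCount f zero    = 0
sqfreeCount f (suc N) =
  sqfreeCount f N + (if does (squareFree? (f (suc N))) then 1 else 0)

-- The constant c_f, via its partial Euler products over primes p ≤ P.

-- local factor 1 - 2/p² (only used at primes, so p ≥ 2)
factor₁ : ℕ → ℚ
factor₁ zero    = 1ℚ
factor₁ (suc m) = 1ℚ ℚ.- (+ 2) ℚ./ (suc m * suc m)

-- local factor (p² - 1)/(p² - 2) (only used at primes, so p ≥ 2)
factor₂ : ℕ → ℚ
factor₂ (suc (suc m)) = (+ (suc (suc m) * suc (suc m) ℕ.∸ 1)) ℚ./ suc ((m + 2) * (m + 2) ℕ.∸ 3)
factor₂ _ = 1ℚ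

prod₁ : ℕ → ℚ
prod₁ zero    = 1ℚ
prod₁ (suc P) = prod₁ P ℚ.* (if does (prime? (suc P)) then factor₁ (suc P) else 1ℚ)

prod₂ : ℕ → ℕ → ℕ → ℚ
prod₂ k ℓ zero    = 1ℚ
prod₂ k ℓ (suc P) = prod₂ k ℓ P ℚ.*
  (if does (prime? (suc P) ×-dec (2 <? suc P) ×-dec (suc P ∣? k * ℓ))
   then factor₂ (suc P) else 1ℚ)

cPartial : ℕ → ℕ → ℕ → ℚ
cPartial k ℓ P = (+ 2 ℚ./ 1) ℚ.* prod₁ P ℚ.* prod₂ k ℓ P

Odd : ℕ → Set
Odd n = ¬ (2 ∣ n)

record TypeA (k ℓ : ℕ) (f : ℕ → ℕ) : Set where
  field
    u v g    : ℕ
    k>1      : 1 < k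
    k-odd    : Odd k
    k<ℓ      : k < ℓ
    ℓ<√3k    : ℓ * ℓ < 3 * (k * k)
    coprime  : gcd k ℓ ≡ 1
    bezout   : (k * k * u ≡ ℓ * ℓ * v + 1) ⊎ (ℓ * ℓ * v ≡ k * k * u + 1)
    g-cases  : (g ≡ 2) ⊎ (g ≡ 4 × Odd ℓ)
    f-def    : ∀ n → f n ≡ (k * k * (1 + 2 * n) + g * v) * (ℓ * ℓ * (1 + 2 * n) + g * u)

-- Type B polynomials.  The fractions k²(2n+½), k²(n+¼), k²(n+¾) are
-- written as the exact natural-number quotients k²(4n+1)/2, k²(4n+1)/4,
-- k²(4n+3)/4 (exact since 2 ∣ k and 2 ∣ ℓ).

data TypeBf (k ℓ u v : ℕ) (f : ℕ → ℕ) : Set where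
  odd-same : Odd u → Odd v → u % 4 ≡ v % 4 →
    (∀ n → f n ≡ (v + k * k * (2 * n + 1)) * (u + ℓ * ℓ * (2 * n + 1))) →
    TypeBf k ℓ u v f
  odd-diff : Odd u → Odd v → ¬ (u % 4 ≡ v % 4) →
    (∀ n → f n ≡ (v + k * k * (4 * n + 1) ℕ./ 2) * (u + ℓ * ℓ * (4 * n + 1) ℕ./ 2)) →
    TypeBf k ℓ u v f
  even-quarter : (u' v' : ℕ) →
    ((2 ∣ u × u' ≡ u × v' ≡ v) ⊎ (2 ∣ v × u' ≡ v × v' ≡ u)) →
    v' % 4 ≡ (u' + 1) % 4 →
    (∀ n → f n ≡ (v + k * k * (4 * n + 1) ℕ./ 4) * (u + ℓ * ℓ * (4 * n + 1) ℕ./ 4)) →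
    TypeBf k ℓ u v f
  even-three-quarter : (u' v' : ℕ) →
    ((2 ∣ u × u' ≡ u × v' ≡ v) ⊎ (2 ∣ v × u' ≡ v × v' ≡ u)) →
    v' % 4 ≡ (u' + 3) % 4 →
    (∀ n → f n ≡ (v + k * k * (4 * n + 3) ℕ./ 4) * (u + ℓ * ℓ * (4 * n + 3) ℕ./ 4)) →
    TypeBf k ℓ u v f

record TypeB (k ℓ : ℕ) (f : ℕ → ℕ) : Set where
  field
    u v      : ℕ
    k-pos    : 0 < k
    k-even   : 2 ∣ k
    ℓ-even   : 2 ∣ ℓ
    k<ℓ      : k < ℓ
    ℓ<√3k    : ℓ * ℓ < 3 * (k * k)
    gcd≡2    : gcd k ℓ ≡ 2
    one-by-4 : (4 ∣ k × ¬ (4 ∣ ℓ)) ⊎ (¬ (4 ∣ k) × 4 ∣ ℓ)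
    bezout   : (k * k * u ≡ ℓ * ℓ * v + 4) ⊎ (ℓ * ℓ * v ≡ k * k * u + 4)
    f-shape  : TypeBf k ℓ u v f

module Submission where

-- Both types give f (n + 1) = d₁ n · d₂ n with linear factors whose resultant is a power of 2
-- (in Type B after halving k and ℓ), and 4 never divides f (n + 1).  Hence an odd prime p divides
-- at most one factor, and p² divides f (n + 1) for exactly ρ p residues n modulo p², where ρ p is
-- 1 if p ∣ k ℓ and 2 otherwise (and ρ 2 = 0).  By the Chinese remainder theorem, the n whose
-- value is free of squares of primes p ≤ z have density exactly ∏_{p ≤ z} (1 - ρ p / p²), which
-- is the partial Euler product cPartial.  A value n < N divisible by p² for a larger prime p must
-- have p² ≤ K N (K the sum of the coefficients of d₁ and d₂), so p ≤ N / (8 z) once N is large,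
-- and each such p excludes at most 2 (N / p² + 1) values; these add up to O(N / z).  Since the
-- tail ∏_{p > z} (1 - 2 / p²) is at least (z - 1) / (z + 1), taking z large gives the
-- asymptotic, and the bound c_f > 0.64 reduces to a finite computation with the primes up to 300.

module FiniteSum where

  open import Data.Nat
  open import Data.Nat.Properties
  open import Data.Nat.DivMod using (m≡m%n+[m/n]*n; m%n<n)
  open import Data.Nat.GCD using (module Bézout)
  open import Data.Nat.Tactic.RingSolver using (solve-∀)
  open import Data.Product using (Σ-syntax; _×_; _,_; proj₁; proj₂)
  open import Data.Sum using (inj₁; inj₂)
  open import Relation.Binary.PropositionalEquality

  ∑< : ℕ → (ℕ → ℕ) → ℕ
  ∑< zero    h = 0
  ∑< (suc N) h = ∑< N h + h N

  syntax ∑< N (λ i → e) = ∑[ i < N ] e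

  ∑-cong : ∀ {h g} N → (∀ n → n < N → h n ≡ g n) → ∑< N h ≡ ∑< N g
  ∑-cong zero    e = refl
  ∑-cong (suc N) e = cong₂ _+_ (∑-cong N (λ n n<N → e n (m<n⇒m<1+n n<N))) (e N ≤-refl)

  ∑-cong′ : ∀ {h g} N → (∀ n → h n ≡ g n) → ∑< N h ≡ ∑< N g
  ∑-cong′ N e = ∑-cong N (λ n _ → e n)

  ∑-mono-≤ : ∀ {h g} N → (∀ n → n < N → h n ≤ g n) → ∑< N h ≤ ∑< N g
  ∑-mono-≤ zero    e = z≤n
  ∑-mono-≤ (suc N) e = +-mono-≤ (∑-mono-≤ N (λ n n<N → e n (m<n⇒m<1+n n<N))) (e N ≤-refl)

  ∑-monoˡ-≤ : ∀ h {M N} → M ≤ N → ∑< M h ≤ ∑< N h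
  ∑-monoˡ-≤ h {N = zero}  z≤n = ≤-refl
  ∑-monoˡ-≤ h {N = suc N} M≤1+N with m≤n⇒m<n∨m≡n M≤1+N
  ... | inj₁ (s≤s M≤N) = ≤-trans (∑-monoˡ-≤ h M≤N) (m≤m+n _ _)
  ... | inj₂ refl      = ≤-refl

  ∑-+ : ∀ h M N → ∑< (M + N) h ≡ ∑< M h + ∑[ n < N ] h (M + n)
  ∑-+ h M zero    = trans (cong (λ x → ∑< x h) (+-identityʳ M)) (sym (+-identityʳ _))
  ∑-+ h M (suc N) rewrite +-suc M N | ∑-+ h M N = +-assoc (∑< M h) _ _

  ∑-rotate : ∀ h q → h q ≡ h 0 → ∑[ n < q ] h (suc n) ≡ ∑< q h
  ∑-rotate h q hq≡h0 = +-cancelˡ-≡ (h 0) _ _ (begin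
    h 0 + ∑[ n < q ] h (suc n) ≡⟨ sym (∑-+ h 1 q) ⟩
    ∑< q h + h q               ≡⟨ cong (∑< q h +_) hq≡h0 ⟩
    ∑< q h + h 0               ≡⟨ +-comm (∑< q h) (h 0) ⟩
    h 0 + ∑< q h               ∎)
    where open ≡-Reasoning

  ∑-distrib-+ : ∀ h g N → ∑[ n < N ] (h n + g n) ≡ ∑< N h + ∑< N g
  ∑-distrib-+ h g zero    = refl
  ∑-distrib-+ h g (suc N) rewrite ∑-distrib-+ h g N = shuffle (∑< N h) (∑< N g) (h N) (g N)
    where shuffle : ∀ a b c d → a + b + (c + d) ≡ a + c + (b + d)
          shuffle = solve-∀

  ∑-*-distribˡ : ∀ c h N → ∑[ n < N ] (c * h n) ≡ c * ∑< N h
  ∑-*-distribˡ c h zero    = sym (*-zeroʳ c)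
  ∑-*-distribˡ c h (suc N) rewrite ∑-*-distribˡ c h N = sym (*-distribˡ-+ c (∑< N h) (h N))

  ∑-*-distribʳ : ∀ c h N → ∑[ n < N ] (h n * c) ≡ ∑< N h * c
  ∑-*-distribʳ c h zero    = refl
  ∑-*-distribʳ c h (suc N) rewrite ∑-*-distribʳ c h N = sym (*-distribʳ-+ c (∑< N h) (h N))

  ∑-const : ∀ c N → ∑[ _ < N ] c ≡ N * c
  ∑-const c zero    = refl
  ∑-const c (suc N) rewrite ∑-const c N = +-comm (N * c) c

  ∑-comm : ∀ (F : ℕ → ℕ → ℕ) A B → ∑[ i < A ] ∑[ j < B ] F i j ≡ ∑[ j < B ] ∑[ i < A ] F i j
  ∑-comm F zero    B = sym (trans (∑-const 0 B) (*-zeroʳ B))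
  ∑-comm F (suc A) B rewrite ∑-comm F A B = sym (∑-distrib-+ (λ j → ∑[ i < A ] F i j) (λ j → F A j) B)

  ∑-blocks : ∀ h Q t → ∑< (t * Q) h ≡ ∑[ j < t ] ∑[ i < Q ] h (j * Q + i)
  ∑-blocks h Q zero    = refl
  ∑-blocks h Q (suc t) rewrite +-comm Q (t * Q) | ∑-+ h (t * Q) Q | ∑-blocks h Q t = refl

  Periodic : ∀ {a} {A : Set a} → (ℕ → A) → ℕ → Set a
  Periodic h Q = ∀ n → h (n + Q) ≡ h n

  module _ {a} {A : Set a} {h : ℕ → A} {Q : ℕ} (per : Periodic h Q) where

    periodic-* : ∀ t n → h (n + t * Q) ≡ h n
    periodic-* zero    n = cong h (+-identityʳ n)
    periodic-* (suc t) n = begin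
      h (n + (Q + t * Q)) ≡⟨ cong h (reassoc n Q (t * Q)) ⟩
      h (n + t * Q + Q)   ≡⟨ per (n + t * Q) ⟩
      h (n + t * Q)       ≡⟨ periodic-* t n ⟩
      h n                 ∎
      where open ≡-Reasoning
            reassoc : ∀ a b c → a + (b + c) ≡ a + c + b
            reassoc = solve-∀

  module _ {a} {A : Set a} {S : ℕ → A} {Q q : ℕ} (perQ : Periodic S Q) (perq : Periodic S q) where

    periodic-coprime⇒constant : Bézout.Identity 1 Q q → ∀ i → S i ≡ S 0
    periodic-coprime⇒constant bézout zero    = refl
    periodic-coprime⇒constant bézout (suc i) = trans (step bézout) (periodic-coprime⇒constant bézout i)
      where
      open ≡-Reasoning
      step : Bézout.Identity 1 Q q → S (suc i) ≡ S i
      step (Bézout.+- x y 1+yq≡xQ) = begin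
        S (suc i)         ≡⟨ sym (periodic-* perq y (suc i)) ⟩
        S (suc i + y * q) ≡⟨ cong S (trans (sym (+-suc i (y * q))) (cong (i +_) 1+yq≡xQ)) ⟩
        S (i + x * Q)     ≡⟨ periodic-* perQ x i ⟩
        S i               ∎
      step (Bézout.-+ x y 1+xQ≡yq) = begin
        S (suc i)         ≡⟨ sym (periodic-* perQ x (suc i)) ⟩
        S (suc i + x * Q) ≡⟨ cong S (trans (sym (+-suc i (x * Q))) (cong (i +_) 1+xQ≡yq)) ⟩
        S (i + y * q)     ≡⟨ periodic-* perq y i ⟩
        S i               ∎

  module _ {h : ℕ → ℕ} {Q : ℕ} (per : Periodic h Q) where

    ∑-periodic-window : ∀ m → ∑[ j < Q ] h (m + j) ≡ ∑< Q h
    ∑-periodic-window zero    = refl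
    ∑-periodic-window (suc m) = begin
      ∑[ j < Q ] h (suc m + j) ≡⟨ ∑-cong′ Q (λ j → cong h (sym (+-suc m j))) ⟩
      ∑[ j < Q ] h (m + suc j) ≡⟨ ∑-rotate (λ j → h (m + j)) Q (trans (per m) (cong h (sym (+-identityʳ m)))) ⟩
      ∑[ j < Q ] h (m + j)     ≡⟨ ∑-periodic-window m ⟩
      ∑< Q h                   ∎
      where open ≡-Reasoning

    ∑-periodic-split : ∀ t r → r ≤ Q →
      Σ[ R ∈ ℕ ] (∑< (t * Q + r) h ≡ t * ∑< Q h + R) × R ≤ ∑< Q h
    ∑-periodic-split t r r≤Q = tail , split , tail≤
      where
      open ≡-Reasoning
      tail = ∑[ n < r ] h (t * Q + n)
      split : ∑< (t * Q + r) h ≡ t * ∑< Q h + tail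
      split = begin
        ∑< (t * Q + r) h                             ≡⟨ ∑-+ h (t * Q) r ⟩
        ∑< (t * Q) h + tail                          ≡⟨ cong (_+ tail) (∑-blocks h Q t) ⟩
        ∑[ j < t ] ∑[ i < Q ] h (j * Q + i) + tail   ≡⟨ cong (_+ tail) (∑-cong′ t (λ j → ∑-periodic-window (j * Q))) ⟩
        ∑[ j < t ] ∑< Q h + tail                     ≡⟨ cong (_+ tail) (∑-const (∑< Q h) t) ⟩
        t * ∑< Q h + tail                            ∎
      tail≤ : tail ≤ ∑< Q h
      tail≤ = ≤-trans (∑-monoˡ-≤ _ r≤Q) (≤-reflexive (∑-periodic-window (t * Q)))

    module _ .{{_ : NonZero Q}} (N : ℕ) where

      private
        t = N / Q
        r = N % Q
        α = ∑< Q h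
        N≡tQ+r : N ≡ t * Q + r
        N≡tQ+r = trans (m≡m%n+[m/n]*n N Q) (+-comm r (t * Q))
        decomposition = ∑-periodic-split t r (<⇒≤ (m%n<n N Q))
        R = proj₁ decomposition
        ∑N≡tα+R : ∑< N h ≡ t * α + R
        ∑N≡tα+R = trans (cong (λ x → ∑< x h) N≡tQ+r) (proj₁ (proj₂ decomposition))
        R≤α = proj₂ (proj₂ decomposition)

      ∑-periodic-upper : Q * ∑< N h ≤ α * N + Q * α
      ∑-periodic-upper = begin
        Q * ∑< N h              ≡⟨ cong (Q *_) ∑N≡tα+R ⟩
        Q * (t * α + R)         ≡⟨ expand Q t α R ⟩
        α * (t * Q) + Q * R     ≤⟨ +-mono-≤ (*-monoʳ-≤ α (m≤m+n (t * Q) r)) (*-monoʳ-≤ Q R≤α) ⟩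
        α * (t * Q + r) + Q * α ≡⟨ cong (λ x → α * x + Q * α) (sym N≡tQ+r) ⟩
        α * N + Q * α           ∎
        where open ≤-Reasoning
              expand : ∀ Q t α R → Q * (t * α + R) ≡ α * (t * Q) + Q * R
              expand = solve-∀

      ∑-periodic-lower : α * N ≤ Q * ∑< N h + Q * α
      ∑-periodic-lower = begin
        α * N                   ≡⟨ cong (α *_) N≡tQ+r ⟩
        α * (t * Q + r)         ≡⟨ expand α t Q r ⟩
        Q * (t * α) + r * α     ≤⟨ +-mono-≤ (*-monoʳ-≤ Q (m≤m+n (t * α) R)) (*-monoˡ-≤ α (<⇒≤ (m%n<n N Q))) ⟩
        Q * (t * α + R) + Q * α ≡⟨ cong (λ x → Q * x + Q * α) (sym ∑N≡tα+R) ⟩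
        Q * ∑< N h + Q * α      ∎
        where open ≤-Reasoning
              expand : ∀ α t Q r → α * (t * Q + r) ≡ Q * (t * α) + r * α
              expand = solve-∀

  ∑-periodic-product : ∀ {hA hB : ℕ → ℕ} {Q q} .{{_ : NonZero q}} →
    Periodic hA Q → Periodic hB q → Bézout.Identity 1 Q q →
    ∑[ n < q * Q ] (hA n * hB n) ≡ ∑< Q hA * ∑< q hB
  ∑-periodic-product {hA} {hB} {Q} {q} perA perB bézout = begin
    ∑[ n < q * Q ] (hA n * hB n)                          ≡⟨ ∑-blocks _ Q q ⟩
    ∑[ j < q ] ∑[ i < Q ] (hA (j * Q + i) * hB (j * Q + i)) ≡⟨ ∑-cong′ q (λ j → ∑-cong′ Q (λ i → cong (_* hB (j * Q + i)) (reduceA j i))) ⟩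
    ∑[ j < q ] ∑[ i < Q ] (hA i * hB (j * Q + i))         ≡⟨ sym (∑-comm (λ i j → hA i * hB (j * Q + i)) Q q) ⟩
    ∑[ i < Q ] ∑[ j < q ] (hA i * hB (j * Q + i))         ≡⟨ ∑-cong′ Q (λ i → ∑-*-distribˡ (hA i) (λ j → hB (j * Q + i)) q) ⟩
    ∑[ i < Q ] (hA i * S i)                               ≡⟨ ∑-cong′ Q (λ i → cong (hA i *_) (trans (S-constant i) S0≡β)) ⟩
    ∑[ i < Q ] (hA i * β)                                 ≡⟨ ∑-*-distribʳ β hA Q ⟩
    ∑< Q hA * β                                           ∎
    where
    open ≡-Reasoning
    β = ∑< q hB
    -- S has the coprime periods Q and q, hence is constant.
    S : ℕ → ℕ
    S i = ∑[ j < q ] hB (j * Q + i)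
    reduceA : ∀ j i → hA (j * Q + i) ≡ hA i
    reduceA j i = trans (cong hA (+-comm (j * Q) i)) (periodic-* perA j i)
    S-periodic-Q : Periodic S Q
    S-periodic-Q i = begin
      S (i + Q)                         ≡⟨ ∑-cong′ q (λ j → cong hB (shift j Q i)) ⟩
      ∑[ j < q ] hB (suc j * Q + i)     ≡⟨ ∑-rotate (λ j → hB (j * Q + i)) q wrap ⟩
      S i                               ∎
      where
      shift : ∀ j Q i → j * Q + (i + Q) ≡ suc j * Q + i
      shift = solve-∀
      wrap : hB (q * Q + i) ≡ hB (0 * Q + i)
      wrap = trans (cong hB (trans (+-comm (q * Q) i) (cong (i +_) (*-comm q Q)))) (periodic-* perB Q i)
    S-periodic-q : Periodic S q
    S-periodic-q i = ∑-cong′ q (λ j → trans (cong hB (sym (+-assoc (j * Q) i q))) (perB _))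
    S-constant : ∀ i → S i ≡ S 0
    S-constant = periodic-coprime⇒constant S-periodic-Q S-periodic-q bézout
    S0≡β : S 0 ≡ β
    S0≡β = *-cancelˡ-≡ (S 0) β q (begin
      q * S 0                          ≡⟨ sym (∑-const (S 0) q) ⟩
      ∑[ _ < q ] S 0                   ≡⟨ ∑-cong′ q (λ i → sym (S-constant i)) ⟩
      ∑< q S                           ≡⟨ ∑-comm (λ i j → hB (j * Q + i)) q q ⟩
      ∑[ j < q ] ∑[ i < q ] hB (j * Q + i) ≡⟨ ∑-cong′ q (λ j → ∑-periodic-window perB (j * Q)) ⟩
      ∑[ _ < q ] β                     ≡⟨ ∑-const β q ⟩
      q * β                            ∎)

module Counting where

  open import Data.Bool using (Bool; true; false; _∧_; _∨_; not; T)
  open import Data.Empty using (⊥-elim)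
  open import Data.Nat
  open import Data.Nat.Properties
  open import Data.Nat.DivMod using (m≡m%n+[m/n]*n; m%n<n)
  open import Relation.Binary.PropositionalEquality
  open import Function using (_∘_)
  open import Relation.Nullary using (¬_; Dec; does; yes; no)
  open FiniteSum

  -- toWitness and fromWitness, stated with does rather than isYes, which need not reduce here.
  T-does⇒ : ∀ {a} {A : Set a} (a? : Dec A) → T (does a?) → A
  T-does⇒ (yes a) _ = a

  ⇒T-does : ∀ {a} {A : Set a} (a? : Dec A) → A → T (does a?)
  ⇒T-does (yes _) _ = _
  ⇒T-does (no ¬a) a = ¬a a

  T-not-does⇒ : ∀ {a} {A : Set a} (a? : Dec A) → T (not (does a?)) → ¬ A
  T-not-does⇒ (no ¬a) _ = ¬a

  ⇒T-not-does : ∀ {a} {A : Set a} (a? : Dec A) → ¬ A → T (not (does a?))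
  ⇒T-not-does (yes a) ¬a = ¬a a
  ⇒T-not-does (no _)  _  = _

  indicator : Bool → ℕ
  indicator true  = 1
  indicator false = 0

  count : (ℕ → Bool) → ℕ → ℕ
  count P N = ∑[ n < N ] indicator (P n)

  indicator-∧ : ∀ x y → indicator (x ∧ y) ≡ indicator x * indicator y
  indicator-∧ true  y = sym (+-identityʳ (indicator y))
  indicator-∧ false y = refl

  count-none : ∀ P N → (∀ n → n < N → ¬ T (P n)) → count P N ≡ 0
  count-none P N none = trans (∑-cong N (λ n n<N → vanish (P n) (none n n<N))) (trans (∑-const 0 N) (*-zeroʳ N))
    where vanish : ∀ x → ¬ T x → indicator x ≡ 0
          vanish true  ¬x = ⊥-elim (¬x _)
          vanish false _  = refl

  count-mono : ∀ P B N → (∀ n → n < N → T (P n) → T (B n)) → count P N ≤ count B N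
  count-mono P B N P⇒B = ∑-mono-≤ N (λ n n<N → mono (P n) (B n) (P⇒B n n<N))
    where mono : ∀ x y → (T x → T y) → indicator x ≤ indicator y
          mono true  true  _   = ≤-refl
          mono true  false x⇒y = ⊥-elim (x⇒y _)
          mono false y     _   = z≤n

  count-∨ : ∀ P B N → count (λ n → P n ∨ B n) N ≤ count P N + count B N
  count-∨ P B N = ≤-trans (∑-mono-≤ N (λ n _ → subadditive (P n) (B n))) (≤-reflexive (∑-distrib-+ _ _ N))
    where subadditive : ∀ x y → indicator (x ∨ y) ≤ indicator x + indicator y
          subadditive true  y = s≤s z≤n
          subadditive false y = ≤-refl

  count-∨-disjoint : ∀ P B N → (∀ n → T (P n) → ¬ T (B n)) →
    count (λ n → P n ∨ B n) N ≡ count P N + count B N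
  count-∨-disjoint P B N disjoint = trans (∑-cong′ N (λ n → additive (P n) (B n) (disjoint n))) (∑-distrib-+ _ _ N)
    where additive : ∀ x y → (T x → ¬ T y) → indicator (x ∨ y) ≡ indicator x + indicator y
          additive true  true  x⇒¬y = ⊥-elim (x⇒¬y _ _)
          additive true  false _ = refl
          additive false y     _ = refl

  count-not : ∀ P N → count (λ n → not (P n)) N + count P N ≡ N
  count-not P N = trans (sym (∑-distrib-+ _ _ N)) (trans (∑-cong′ N (λ n → complement (P n)))
    (trans (∑-const 1 N) (*-identityʳ N)))
    where complement : ∀ x → indicator (not x) + indicator x ≡ 1
          complement true  = refl
          complement false = refl

  count-witness : ∀ P {r} N → r < N → T (P r) → 1 ≤ count P N
  count-witness P {r} (suc N) r<1+N Pr with r ≟ N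
  ... | yes refl = ≤-trans (positive (P r) Pr) (m≤n+m _ (count P r))
    where positive : ∀ x → T x → 1 ≤ indicator x
          positive true _ = ≤-refl
  ... | no r≢N   = ≤-trans (count-witness P N (≤∧≢⇒< (≤-pred r<1+N) r≢N) Pr) (m≤m+n _ _)

  Spaced : (ℕ → Bool) → ℕ → Set
  Spaced P q = ∀ n d → 0 < d → d < q → T (P n) → ¬ T (P (n + d))

  module _ {P : ℕ → Bool} {q : ℕ} (spaced : Spaced P q) where

    count-spaced-window : ∀ m L → L ≤ q → count (λ j → P (m + j)) L ≤ 1
    count-spaced-window m zero    _   = z≤n
    count-spaced-window m (suc L) L<q with P (m + L) in PmL
    ... | false = ≤-trans (≤-reflexive (+-identityʳ _)) (count-spaced-window m L (<⇒≤ L<q))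
    ... | true  = ≤-reflexive (cong (_+ 1) (count-none _ L earlier))
      where
      earlier : ∀ j → j < L → ¬ T (P (m + j))
      earlier j j<L Pmj = spaced (m + j) (L ∸ j) (m<n⇒0<n∸m j<L) (≤-<-trans (m∸n≤m L j) L<q) Pmj
        (subst (T ∘ P) (sym (trans (+-assoc m j (L ∸ j)) (cong (m +_) (m+[n∸m]≡n (<⇒≤ j<L))))) (subst T (sym PmL) _))

    count-spaced : .{{_ : NonZero q}} → ∀ N → count P N ≤ N / q + 1
    count-spaced N = begin
      count P N                                          ≡⟨ cong (count P) N≡tq+r ⟩
      count P (t * q + r)                                ≡⟨ ∑-+ _ (t * q) r ⟩
      count P (t * q) + count (λ n → P (t * q + n)) r    ≤⟨ +-mono-≤ blocks (count-spaced-window (t * q) r (<⇒≤ (m%n<n N q))) ⟩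
      t + 1                                              ∎
      where
      open ≤-Reasoning
      t = N / q
      r = N % q
      N≡tq+r : N ≡ t * q + r
      N≡tq+r = trans (m≡m%n+[m/n]*n N q) (+-comm r (t * q))
      blocks : count P (t * q) ≤ t
      blocks = begin
        count P (t * q)                            ≡⟨ ∑-blocks _ q t ⟩
        ∑[ j < t ] count (λ i → P (j * q + i)) q   ≤⟨ ∑-mono-≤ t (λ j _ → count-spaced-window (j * q) q ≤-refl) ⟩
        ∑[ _ < t ] 1                               ≡⟨ trans (∑-const 1 t) (*-identityʳ t) ⟩
        t                                          ∎

module Divisibility where

  open import Data.Empty using (⊥; ⊥-elim)
  open import Data.Nat
  open import Data.Nat.Properties
  open import Data.Nat.Coprimality using (Coprime; coprime-divisor)
  open import Data.Nat.Divisibility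
  open import Data.Nat.GCD using (gcd; gcd-greatest)
  open import Data.Nat.Primality
  open import Data.Nat.Tactic.RingSolver using (solve-∀)
  open import Data.Product using (_×_; _,_)
  open import Data.Sum using (_⊎_; inj₁; inj₂)
  open import Relation.Binary.PropositionalEquality
  open import Relation.Nullary using (¬_; yes; no)
  open import Defs using (Odd)
  open import Function using (_∘′_)
  open import Function.Bundles using (_⇔_; mk⇔)

  prime∤⇒coprime : ∀ {p n} → Prime p → ¬ p ∣ n → Coprime p n
  prime∤⇒coprime p-prime p∤n {d} (d∣p , d∣n) with prime⇒irreducible p-prime d∣p
  ... | inj₁ d≡1 = d≡1
  ... | inj₂ refl = ⊥-elim (p∤n d∣n)

  coprime-square : ∀ {p a} → Coprime p a → Coprime (p * p) a
  coprime-square {p} {a} p⊥a {d} (d∣pp , d∣a) = p⊥a (coprime-divisor d⊥p d∣pp , d∣a)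
    where d⊥p : Coprime d p
          d⊥p (e∣d , e∣p) = p⊥a (e∣p , ∣-trans e∣d d∣a)

  prime∣square⇒∣ : ∀ {p x} → Prime p → p ∣ x * x → p ∣ x
  prime∣square⇒∣ {x = x} p-prime p∣xx with euclidsLemma x x p-prime p∣xx
  ... | inj₁ p∣x = p∣x
  ... | inj₂ p∣x = p∣x

  prime-square∣* : ∀ {p x y} → Prime p → ¬ (p ∣ x × p ∣ y) → p * p ∣ x * y → p * p ∣ x ⊎ p * p ∣ y
  prime-square∣* {p} {x} {y} p-prime ¬both pp∣xy with p ∣? y
  ... | no  p∤y = inj₁ (coprime-divisor (coprime-square (prime∤⇒coprime p-prime p∤y)) (subst (p * p ∣_) (*-comm x y) pp∣xy))
  ... | yes p∣y = inj₂ (coprime-divisor (coprime-square (prime∤⇒coprime p-prime (λ p∣x → ¬both (p∣x , p∣y)))) pp∣xy)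

  odd-prime∤2^ : ∀ {p} → Prime p → p ≢ 2 → ∀ j → ¬ p ∣ 2 ^ j
  odd-prime∤2^ p-prime p≢2 zero    p∣1 = ¬prime[1] (subst Prime (∣1⇒≡1 p∣1) p-prime)
  odd-prime∤2^ p-prime p≢2 (suc j) p∣2^j+1 with euclidsLemma 2 (2 ^ j) p-prime p∣2^j+1
  ... | inj₂ p∣2^j = odd-prime∤2^ p-prime p≢2 j p∣2^j
  ... | inj₁ p∣2 with prime⇒irreducible prime[2] p∣2
  ...   | inj₁ refl = ¬prime[1] p-prime
  ...   | inj₂ p≡2  = p≢2 p≡2

  odd-prime∣2^*⇒∣ : ∀ {p} i y → Prime p → p ≢ 2 → p ∣ 2 ^ i * y → p ∣ y
  odd-prime∣2^*⇒∣ i y p-prime p≢2 p∣2^iy with euclidsLemma (2 ^ i) y p-prime p∣2^iy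
  ... | inj₁ p∣2^i = ⊥-elim (odd-prime∤2^ p-prime p≢2 i p∣2^i)
  ... | inj₂ p∣y   = p∣y

  gcd∈1,2⇒no-common-odd-prime : ∀ {k ℓ} → gcd k ℓ ≡ 1 ⊎ gcd k ℓ ≡ 2 →
    ∀ p → Prime p → p ≢ 2 → p ∣ k → p ∣ ℓ → ⊥
  gcd∈1,2⇒no-common-odd-prime gcd≡ p p-prime p≢2 p∣k p∣ℓ with gcd-greatest p∣k p∣ℓ | gcd≡
  ... | p∣gcd | inj₁ gcd≡1 = ¬prime[1] (subst Prime (∣1⇒≡1 (subst (p ∣_) gcd≡1 p∣gcd)) p-prime)
  ... | p∣gcd | inj₂ gcd≡2 = odd-prime∤2^ p-prime p≢2 1 (subst (p ∣_) gcd≡2 p∣gcd)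

  ¬2∣1 : ¬ 2 ∣ 1
  ¬2∣1 2∣1 with s≤s () ← ∣⇒≤ 2∣1

  odd-* : ∀ {x y} → Odd x → Odd y → Odd (x * y)
  odd-* {x} {y} odd-x odd-y 2∣xy with euclidsLemma x y prime[2] 2∣xy
  ... | inj₁ 2∣x = odd-x 2∣x
  ... | inj₂ 2∣y = odd-y 2∣y

  odd+even : ∀ {a b} → Odd a → 2 ∣ b → Odd (a + b)
  odd+even {a} {b} odd-a 2∣b 2∣a+b = odd-a (∣m+n∣m⇒∣n (subst (2 ∣_) (+-comm a b) 2∣a+b) 2∣b)

  even+odd : ∀ {a b} → 2 ∣ a → Odd b → Odd (a + b)
  even+odd 2∣a odd-b 2∣a+b = odd-b (∣m+n∣m⇒∣n 2∣a+b 2∣a)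

  odd*odd-¬4∣ : ∀ {x y} → Odd x → Odd y → ¬ (2 * 2 ∣ x * y)
  odd*odd-¬4∣ odd-x odd-y 4∣xy = odd-* odd-x odd-y (∣-trans (divides 2 refl) 4∣xy)

  even-* : ∀ {a} b → 2 ∣ a → 2 ∣ a * b
  even-* b 2∣a = ∣m⇒∣m*n b 2∣a

  odd-1+2m : ∀ m → Odd (1 + 2 * m)
  odd-1+2m m = even+odd {2 * m} {1} (divides m (*-comm 2 m)) ¬2∣1 ∘′ subst (2 ∣_) (+-comm 1 (2 * m))

  odd-4m+c : ∀ m {c} → Odd c → Odd (4 * m + c)
  odd-4m+c m odd-c = even+odd (divides (2 * m) (four m)) odd-c
    where four : ∀ m → 4 * m ≡ 2 * m * 2
          four = solve-∀

  odd*even-¬4∣ : ∀ {x y} → Odd x → Odd y → ¬ (2 * 2 ∣ x * (2 * y))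
  odd*even-¬4∣ {x} {y} odd-x odd-y 4∣x2y = odd-* odd-x odd-y (*-cancelˡ-∣ 2 (subst (2 * 2 ∣_) (regroup x y) 4∣x2y))
    where regroup : ∀ x y → x * (2 * y) ≡ 2 * (x * y)
          regroup = solve-∀

  odd-prime∣2^*⇔ : ∀ {p} → Prime p → p ≢ 2 → ∀ i y → p ∣ 2 ^ i * y ⇔ p ∣ y
  odd-prime∣2^*⇔ p-prime p≢2 i y = mk⇔ (odd-prime∣2^*⇒∣ i y p-prime p≢2) (∣n⇒∣m*n (2 ^ i))

  prime∣square⇔ : ∀ {p x} → Prime p → p ∣ x * x ⇔ p ∣ x
  prime∣square⇔ {x = x} p-prime = mk⇔ (prime∣square⇒∣ p-prime) (∣m⇒∣m*n x)

module LinearCongruence where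

  open import Data.Bool using (Bool; T)
  open import Data.Nat
  open import Data.Nat.Properties
  open import Data.Nat.Coprimality using (Coprime; coprime-divisor; coprime-Bézout)
  import Data.Nat.Coprimality as Coprimality
  open import Data.Nat.Divisibility
  open import Data.Nat.DivMod using (m≡m%n+[m/n]*n; m%n<n)
  open import Data.Nat.GCD using (module Bézout)
  open import Data.Nat.Tactic.RingSolver using (solve-∀)
  open import Data.Product using (Σ-syntax; _,_; proj₁; proj₂)
  open import Relation.Binary.PropositionalEquality
  open import Relation.Nullary using (¬_; does)
  open Counting

  isRoot : (m a b : ℕ) → ℕ → Bool
  isRoot m a b n = does (m ∣? a * n + b)

  count-roots-none : ∀ {d m a b} → d ∣ m → d ∣ a → ¬ d ∣ b → ∀ N → count (isRoot m a b) N ≡ 0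
  count-roots-none {d} {m} {a} {b} d∣m d∣a d∤b N = count-none _ N noRoot
    where noRoot : ∀ n → n < N → ¬ T (isRoot m a b n)
          noRoot n _ root = d∤b (∣m+n∣m⇒∣n (∣-trans d∣m (T-does⇒ (m ∣? _) root)) (∣m⇒∣m*n n d∣a))

  module _ {m a : ℕ} .{{_ : NonZero m}} (m⊥a : Coprime m a) (b : ℕ) where

    roots-differ-by-multiple : ∀ n d → m ∣ a * n + b → m ∣ a * (n + d) + b → m ∣ d
    roots-differ-by-multiple n d m∣root m∣root+d = coprime-divisor m⊥a
      (∣m+n∣m⇒∣n (subst (m ∣_) (expand a n d b) m∣root+d) m∣root)
      where expand : ∀ a n d b → a * (n + d) + b ≡ (a * n + b) + a * d
            expand = solve-∀

    roots-spaced : Spaced (isRoot m a b) m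
    roots-spaced n d 0<d d<m root root+d = <⇒≱ d<m (∣⇒≤ {{>-nonZero 0<d}}
      (roots-differ-by-multiple n d (T-does⇒ (m ∣? _) root) (T-does⇒ (m ∣? _) root+d)))

    -- Bézout gives x with x a ≡ ±1 (mod m), and then n ≡ ∓ x b is a root.
    root-exists : Σ[ n ∈ ℕ ] m ∣ a * n + b
    root-exists with coprime-Bézout (Coprimality.sym m⊥a)
    ... | Bézout.+- x y 1+ym≡xa = x * b * pred m , divides (b + y * b * pred m) root
      where
      open ≡-Reasoning
      s = pred m
      m≡1+s : m ≡ suc s
      m≡1+s = sym (suc-pred m)
      regroup : ∀ a x b s → a * (x * b * s) + b ≡ (x * a) * (b * s) + b
      regroup = solve-∀
      factor : ∀ y b s → (1 + y * suc s) * (b * s) + b ≡ (b + y * b * s) * suc s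
      factor = solve-∀
      root : a * (x * b * s) + b ≡ (b + y * b * s) * m
      root = begin
        a * (x * b * s) + b               ≡⟨ regroup a x b s ⟩
        (x * a) * (b * s) + b             ≡⟨ cong (λ c → c * (b * s) + b) (sym 1+ym≡xa) ⟩
        (1 + y * m) * (b * s) + b         ≡⟨ cong (λ c → (1 + y * c) * (b * s) + b) m≡1+s ⟩
        (1 + y * suc s) * (b * s) + b     ≡⟨ factor y b s ⟩
        (b + y * b * s) * suc s           ≡⟨ cong ((b + y * b * s) *_) (sym m≡1+s) ⟩
        (b + y * b * s) * m               ∎
    ... | Bézout.-+ x y 1+xa≡ym = x * b , divides (y * b) root
      where
      factor : ∀ a x b → a * (x * b) + b ≡ (1 + x * a) * b
      factor = solve-∀
      regroup : ∀ y m b → y * m * b ≡ y * b * m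
      regroup = solve-∀
      root : a * (x * b) + b ≡ y * b * m
      root = trans (factor a x b) (trans (cong (_* b) 1+xa≡ym) (regroup y m b))

    root-reduced : m ∣ a * (proj₁ root-exists % m) + b
    root-reduced = ∣m+n∣m⇒∣n (subst (m ∣_) split (proj₂ root-exists)) (∣m⇒∣m*n (a * q) ∣-refl)
      where
      n = proj₁ root-exists
      q = n / m
      expand : ∀ a r q m b → a * (r + q * m) + b ≡ m * (a * q) + (a * r + b)
      expand = solve-∀
      split : a * n + b ≡ m * (a * q) + (a * (n % m) + b)
      split = trans (cong (λ c → a * c + b) (m≡m%n+[m/n]*n n m)) (expand a (n % m) q m b)

    count-roots : count (isRoot m a b) m ≡ 1
    count-roots = ≤-antisym (count-spaced-window roots-spaced 0 m ≤-refl)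
      (count-witness (isRoot m a b) m (m%n<n _ m) (⇒T-does (m ∣? _) root-reduced))

module EulerProduct where

  open import Data.Bool using (true; false; if_then_else_)
  open import Data.Nat
  open import Data.Nat.Divisibility using (_∣_; _∣?_; ∣1⇒≡1)
  open import Data.Nat.Primality
  open import Data.Nat.Properties
  open import Data.Nat.Tactic.RingSolver using (solve-∀)
  open import Data.Product using (_×_; _,_)
  open import Data.Sum using (_⊎_; inj₁; inj₂)
  open import Data.Unit using (tt)
  open import Relation.Binary.PropositionalEquality
  open import Relation.Nullary using (¬_; does; yes; no)
  open Divisibility using (prime∣square⇒∣)

  ∏-primes : (ℕ → ℕ) → ℕ → ℕ
  ∏-primes F zero    = 1
  ∏-primes F (suc z) = if does (prime? (suc z)) then ∏-primes F z * F (suc z) else ∏-primes F z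

  primorial² : ℕ → ℕ
  primorial² = ∏-primes (λ p → p * p)

  -- The number of residues modulo primorial² z that avoid r p given classes modulo each p².
  unsieved : (ℕ → ℕ) → ℕ → ℕ
  unsieved r = ∏-primes (λ p → p * p ∸ r p)

  -- ρ k ℓ p is the number of roots of f modulo p² (count-square∣g).
  ρ : ℕ → ℕ → ℕ → ℕ
  ρ k ℓ p = if does (p ≟ 2) then 0 else if does (p ∣? k * ℓ) then 1 else 2

  ρ₂ : ℕ → ℕ
  ρ₂ p = if does (p ≟ 2) then 0 else 2

  ρ≤ρ₂ : ∀ k ℓ p → ρ k ℓ p ≤ ρ₂ p
  ρ≤ρ₂ k ℓ p with does (p ≟ 2) | does (p ∣? k * ℓ)
  ... | true  | _     = z≤n
  ... | false | true  = s≤s z≤n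
  ... | false | false = ≤-refl

  ρ₂≤2 : ∀ p → ρ₂ p ≤ 2
  ρ₂≤2 p with does (p ≟ 2)
  ... | true  = z≤n
  ... | false = ≤-refl

  primorial²-nonZero : ∀ z → NonZero (primorial² z)
  primorial²-nonZero zero    = _
  primorial²-nonZero (suc z) with prime? (suc z)
  ... | yes _ = m*n≢0 (primorial² z) (suc z * suc z) {{primorial²-nonZero z}}
  ... | no  _ = primorial²-nonZero z

  prime∤primorial² : ∀ {p} → Prime p → ∀ z → z < p → ¬ p ∣ primorial² z
  prime∤primorial² p-prime zero    _   p∣1 = ¬prime[1] (subst Prime (∣1⇒≡1 p∣1) p-prime)
  prime∤primorial² p-prime (suc z) z<p p∣Q with prime? (suc z)
  ... | no  _ = prime∤primorial² p-prime z (<-trans (n<1+n z) z<p) p∣Q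
  ... | yes q-prime with euclidsLemma (primorial² z) (suc z * suc z) p-prime p∣Q
  ...   | inj₁ p∣Q′ = prime∤primorial² p-prime z (<-trans (n<1+n z) z<p) p∣Q′
  ...   | inj₂ p∣qq with prime⇒irreducible q-prime (prime∣square⇒∣ p-prime p∣qq)
  ...     | inj₁ refl = ¬prime[1] p-prime
  ...     | inj₂ refl = <-irrefl refl z<p

  ∏-primes-mono-≤ : ∀ {F G} → (∀ p → F p ≤ G p) → ∀ z → ∏-primes F z ≤ ∏-primes G z
  ∏-primes-mono-≤ F≤G zero    = ≤-refl
  ∏-primes-mono-≤ F≤G (suc z) with prime? (suc z)
  ... | yes _ = *-mono-≤ (∏-primes-mono-≤ F≤G z) (F≤G (suc z))
  ... | no  _ = ∏-primes-mono-≤ F≤G z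

  unsieved≤primorial² : ∀ r z → unsieved r z ≤ primorial² z
  unsieved≤primorial² r = ∏-primes-mono-≤ (λ p → m∸n≤m (p * p) (r p))

  unsieved-antitone : ∀ {r r′} → (∀ p → r p ≤ r′ p) → ∀ z → unsieved r′ z ≤ unsieved r z
  unsieved-antitone {r} {r′} r≤r′ = ∏-primes-mono-≤ (λ p → ∸-monoʳ-≤ (p * p) (r≤r′ p))

  ∏-primes-ratio-antitone : ∀ {F G} → (∀ p → F p ≤ G p) → ∀ z d →
    ∏-primes F (z + d) * ∏-primes G z ≤ ∏-primes F z * ∏-primes G (z + d)
  ∏-primes-ratio-antitone F≤G z zero rewrite +-identityʳ z = ≤-refl
  ∏-primes-ratio-antitone {F} {G} F≤G z (suc d) rewrite +-suc z d with prime? (suc (z + d))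
  ... | no  _ = ∏-primes-ratio-antitone F≤G z d
  ... | yes _ = begin
    ∏-primes F P * F p * ∏-primes G z         ≡⟨ swap (∏-primes F P) (F p) (∏-primes G z) ⟩
    ∏-primes F P * ∏-primes G z * F p         ≤⟨ *-mono-≤ (∏-primes-ratio-antitone F≤G z d) (F≤G p) ⟩
    ∏-primes F z * ∏-primes G P * G p         ≡⟨ *-assoc (∏-primes F z) (∏-primes G P) (G p) ⟩
    ∏-primes F z * (∏-primes G P * G p)       ∎
    where
    open ≤-Reasoning
    P = z + d
    p = suc P
    swap : ∀ a b c → a * b * c ≡ a * c * b
    swap = solve-∀

  primes-step : ∀ r P → let p = suc P in
    (unsieved r p ≡ unsieved r P * (p * p ∸ r p) × primorial² p ≡ primorial² P * (p * p))
    ⊎ (unsieved r p ≡ unsieved r P × primorial² p ≡ primorial² P)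
  primes-step r P with prime? (suc P)
  ... | yes _ = inj₁ (refl , refl)
  ... | no  _ = inj₂ (refl , refl)

  private
    +2-nonZero : ∀ s → NonZero (s + 2)
    +2-nonZero s = >-nonZero (≤-trans (s≤s z≤n) (m≤n+m 2 s))

  -- For z = z′ + 1 ≥ 2 and P ≥ z, ∏_{z < p ≤ P} (1 - r p / p²) ≥ (z - 1) / (z + 1): the factor at
  -- n = s + 2 is at least (n² - 2) / n² ≥ (s (s + 3)) / ((s + 1) (s + 2)), which telescopes.
  module _ (r : ℕ → ℕ) (r≤2 : ∀ p → 3 ≤ p → r p ≤ 2) (z′ : ℕ) (1≤z′ : 1 ≤ z′) where

    private
      z = suc z′
      lhs rhs : ℕ → ℕ
      lhs P = unsieved r z * primorial² P * z′
      rhs P = unsieved r P * primorial² z * (z′ + 2)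

      composite-step : ∀ s a b → a * (s + 2) ≤ b * s → a * (s + 3) ≤ b * (s + 1)
      composite-step s a b a[s+2]≤bs = *-cancelˡ-≤ (s + 2) {{+2-nonZero s}} (begin
        (s + 2) * (a * (s + 3)) ≡⟨ regroup s a ⟩
        (a * (s + 2)) * (s + 3) ≤⟨ *-monoˡ-≤ (s + 3) a[s+2]≤bs ⟩
        (b * s) * (s + 3)       ≡⟨ *-assoc b s (s + 3) ⟩
        b * (s * (s + 3))       ≤⟨ *-monoʳ-≤ b (≤-trans (m≤m+n (s * (s + 3)) 2) (≤-reflexive (expand s))) ⟩
        b * ((s + 1) * (s + 2)) ≡⟨ regroup′ s b ⟩
        (s + 2) * (b * (s + 1)) ∎)
        where
        open ≤-Reasoning
        regroup : ∀ s a → (s + 2) * (a * (s + 3)) ≡ (a * (s + 2)) * (s + 3)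
        regroup = solve-∀
        expand : ∀ s → s * (s + 3) + 2 ≡ (s + 1) * (s + 2)
        expand = solve-∀
        regroup′ : ∀ s b → b * ((s + 1) * (s + 2)) ≡ (s + 2) * (b * (s + 1))
        regroup′ = solve-∀

      prime-step : ∀ s a b e → s * s + 4 * s + 2 ≤ e → a * (s + 2) ≤ b * s →
                   a * ((s + 2) * (s + 2)) * (s + 3) ≤ b * e * (s + 1)
      prime-step s a b e n²-2≤e a[s+2]≤bs = *-cancelˡ-≤ (s + 2) {{+2-nonZero s}} (begin
        (s + 2) * (a * ((s + 2) * (s + 2)) * (s + 3))  ≡⟨ regroup s a ⟩
        (a * (s + 2)) * ((s + 2) * (s + 2) * (s + 3))  ≤⟨ *-monoˡ-≤ _ a[s+2]≤bs ⟩
        (b * s) * ((s + 2) * (s + 2) * (s + 3))        ≡⟨ regroup′ s b ⟩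
        b * (s + 2) * (s * (s + 2) * (s + 3))          ≤⟨ *-monoʳ-≤ (b * (s + 2)) (≤-trans (m≤m+n _ 2) (≤-reflexive (expand s))) ⟩
        b * (s + 2) * ((s * s + 4 * s + 2) * (s + 1))  ≤⟨ *-monoʳ-≤ (b * (s + 2)) (*-monoˡ-≤ (s + 1) n²-2≤e) ⟩
        b * (s + 2) * (e * (s + 1))                    ≡⟨ regroup″ s b e ⟩
        (s + 2) * (b * e * (s + 1))                    ∎)
        where
        open ≤-Reasoning
        regroup : ∀ s a → (s + 2) * (a * ((s + 2) * (s + 2)) * (s + 3)) ≡ (a * (s + 2)) * ((s + 2) * (s + 2) * (s + 3))
        regroup = solve-∀
        regroup′ : ∀ s b → (b * s) * ((s + 2) * (s + 2) * (s + 3)) ≡ b * (s + 2) * (s * (s + 2) * (s + 3))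
        regroup′ = solve-∀
        expand : ∀ s → s * (s + 2) * (s + 3) + 2 ≡ (s * s + 4 * s + 2) * (s + 1)
        expand = solve-∀
        regroup″ : ∀ s b e → b * (s + 2) * (e * (s + 1)) ≡ (s + 2) * (b * e * (s + 1))
        regroup″ = solve-∀

      n²-2≤n²-r : ∀ s → 1 ≤ s → let n = suc (suc s) in s * s + 4 * s + 2 ≤ n * n ∸ r n
      n²-2≤n²-r s 1≤s = begin
        s * s + 4 * s + 2                   ≡⟨ sym (m+n∸n≡m _ 2) ⟩
        s * s + 4 * s + 2 + 2 ∸ 2           ≡⟨ cong (_∸ 2) (expand s) ⟩
        n * n ∸ 2                           ≤⟨ ∸-monoʳ-≤ (n * n) (r≤2 n (s≤s (s≤s 1≤s))) ⟩
        n * n ∸ r n                         ∎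
        where
        open ≤-Reasoning
        n = suc (suc s)
        expand : ∀ s → s * s + 4 * s + 2 + 2 ≡ suc (suc s) * suc (suc s)
        expand = solve-∀

      telescope : ∀ d → lhs (z + d) * (z′ + d + 2) ≤ rhs (z + d) * (z′ + d)
      telescope zero rewrite +-identityʳ z′ = ≤-reflexive (swap (unsieved r z) (primorial² z) z′)
        where swap : ∀ a q z′ → a * q * z′ * (z′ + 2) ≡ a * q * (z′ + 2) * z′
              swap = solve-∀
      telescope (suc d) rewrite +-suc z′ d = step (primes-step r (z + d))
        where
        s = z′ + d
        p = suc (z + d)
        e = p * p ∸ r p
        step : (unsieved r p ≡ unsieved r (z + d) * e × primorial² p ≡ primorial² (z + d) * (p * p))
               ⊎ (unsieved r p ≡ unsieved r (z + d) × primorial² p ≡ primorial² (z + d)) →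
               lhs p * (suc s + 2) ≤ rhs p * suc s
        step (inj₂ (U≡ , Q≡)) = subst₂ _≤_
          (cong₂ _*_ (cong (λ q → unsieved r z * q * z′) (sym Q≡)) (+-suc s 2))
          (cong₂ _*_ (cong (λ u → u * primorial² z * (z′ + 2)) (sym U≡)) (+-comm s 1))
          (composite-step s (lhs (z + d)) (rhs (z + d)) (telescope d))
        step (inj₁ (U≡ , Q≡)) = subst₂ _≤_
          (trans (regroup (unsieved r z) (primorial² (z + d)) z′ s) (cong (λ q → unsieved r z * q * z′ * (suc s + 2)) (sym Q≡)))
          (trans (regroup′ (unsieved r (z + d)) (primorial² z) z′ e s) (cong (λ u → u * primorial² z * (z′ + 2) * suc s) (sym U≡)))
          (prime-step s (lhs (z + d)) (rhs (z + d)) e (n²-2≤n²-r s (≤-trans 1≤z′ (m≤m+n z′ d))) (telescope d))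
          where
          regroup : ∀ a q z′ s → a * q * z′ * ((s + 2) * (s + 2)) * (s + 3) ≡ a * (q * (suc (suc s) * suc (suc s))) * z′ * (suc s + 2)
          regroup = solve-∀
          regroup′ : ∀ c q z′ e s → c * q * (z′ + 2) * e * (s + 1) ≡ c * e * q * (z′ + 2) * suc s
          regroup′ = solve-∀

    unsieved-tail : ∀ d → unsieved r z * primorial² (z + d) * z′ ≤ unsieved r (z + d) * primorial² z * (z′ + 2)
    unsieved-tail d = *-cancelʳ-≤ _ _ (z′ + d + 2) {{+2-nonZero (z′ + d)}}
      (≤-trans (telescope d) (*-monoʳ-≤ (rhs (z + d)) (m≤m+n (z′ + d) 2)))

  -- Kept abstract in z′: with a literal z, type checking would unfold primorial² (z + d).
  module _ (z′ : ℕ) (1≤z′ : 1 ≤ z′) (k ℓ : ℕ) where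

    private
      z = suc z′
      Q = primorial² z

    unsieved-lower-bound-from : 641 * Q * (z′ + 2) ≤ 1000 * unsieved ρ₂ z * z′ →
      ∀ d → 641 * primorial² (z + d) ≤ 1000 * unsieved (ρ k ℓ) (z + d)
    unsieved-lower-bound-from base d =
      *-cancelʳ-≤ _ _ (Q * (z′ + 2)) {{m*n≢0 Q (z′ + 2) {{primorial²-nonZero z}} {{+2-nonZero z′}}}} (begin
        641 * Q′ * (Q * (z′ + 2))                  ≡⟨ regroup Q′ Q (z′ + 2) ⟩
        Q′ * (641 * Q * (z′ + 2))                  ≤⟨ *-monoʳ-≤ Q′ base ⟩
        Q′ * (1000 * unsieved ρ₂ z * z′)           ≡⟨ regroup′ Q′ (unsieved ρ₂ z) z′ ⟩
        1000 * (unsieved ρ₂ z * Q′ * z′)           ≤⟨ *-monoʳ-≤ 1000 (unsieved-tail ρ₂ (λ p _ → ρ₂≤2 p) z′ 1≤z′ d) ⟩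
        1000 * (unsieved ρ₂ P * Q * (z′ + 2))      ≤⟨ *-monoʳ-≤ 1000 (*-monoˡ-≤ (z′ + 2) (*-monoˡ-≤ Q (unsieved-antitone (ρ≤ρ₂ k ℓ) P))) ⟩
        1000 * (unsieved (ρ k ℓ) P * Q * (z′ + 2)) ≡⟨ regroup″ (unsieved (ρ k ℓ) P) Q (z′ + 2) ⟩
        1000 * unsieved (ρ k ℓ) P * (Q * (z′ + 2)) ∎)
      where
      open ≤-Reasoning
      P = z + d
      Q′ = primorial² P
      regroup : ∀ Q′ Q x → 641 * Q′ * (Q * x) ≡ Q′ * (641 * Q * x)
      regroup = solve-∀
      regroup′ : ∀ Q′ u z′ → Q′ * (1000 * u * z′) ≡ 1000 * (u * Q′ * z′)
      regroup′ = solve-∀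
      regroup″ : ∀ u Q x → 1000 * (u * Q * x) ≡ 1000 * u * (Q * x)
      regroup″ = solve-∀

  -- 0.641 ≤ (299 / 301) ∏_{2 < p ≤ 300} (1 - 2 / p²), checked by evaluation.
  unsieved-300 : 641 * primorial² 300 * (299 + 2) ≤ 1000 * unsieved ρ₂ 300 * 299
  unsieved-300 = ≤ᵇ⇒≤ (641 * primorial² 300 * (299 + 2)) (1000 * unsieved ρ₂ 300 * 299) tt

  unsieved-lower-bound : ∀ k ℓ P → 300 ≤ P → 641 * primorial² P ≤ 1000 * unsieved (ρ k ℓ) P
  unsieved-lower-bound k ℓ P 300≤P = subst (λ P → 641 * primorial² P ≤ 1000 * unsieved (ρ k ℓ) P)
    (m+[n∸m]≡n 300≤P) (unsieved-lower-bound-from 299 (s≤s z≤n) k ℓ unsieved-300 (P ∸ 300))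

module SieveBounds where

  open import Data.Nat
  open import Data.Nat.DivMod using (m/n*n≤m)
  open import Data.Nat.Properties
  open import Data.Nat.Tactic.RingSolver using (solve-∀)
  open import Relation.Binary.PropositionalEquality
  open FiniteSum

  module _ (z N : ℕ) (1≤z : 1 ≤ z) where

    private
      inverseSquares : ℕ → ℕ
      inverseSquares r = ∑[ i < r ] (N / ((suc z + i) * (suc z + i)))

    -- Equivalently, the sum is at most N / z - N / (z + r); each new term N / (M + 1)² is at most
    -- N / M - N / (M + 1).
    ∑-inverse-squares-telescope : ∀ r → z * (z + r) * inverseSquares r + z * N ≤ (z + r) * N
    ∑-inverse-squares-telescope zero rewrite +-identityʳ z | *-zeroʳ (z * z) = ≤-refl
    ∑-inverse-squares-telescope (suc r) rewrite +-suc z r = *-cancelˡ-≤ M {{M-nonZero}} (+-cancelʳ-≤ E _ _ (begin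
      M * (z * suc M * (S + t) + z * N) + E                          ≡⟨ expand z M S t N ⟩
      suc M * (z * M * S + z * N) + z * (M * suc M * t) + z * M * N
        ≤⟨ +-monoˡ-≤ (z * M * N) (+-mono-≤ (*-monoʳ-≤ (suc M) (∑-inverse-squares-telescope r)) (*-monoʳ-≤ z MM′t≤N)) ⟩
      suc M * (M * N) + z * N + z * M * N                            ≡⟨ regroup z M N ⟩
      M * (suc M * N) + E                                            ∎))
      where
      open ≤-Reasoning
      M = z + r
      S = inverseSquares r
      t = N / (suc M * suc M)
      E = z * M * N + z * N
      M-nonZero = >-nonZero (≤-trans 1≤z (m≤m+n z r))
      expand : ∀ z M S t N → M * (z * suc M * (S + t) + z * N) + (z * M * N + z * N) ≡
               suc M * (z * M * S + z * N) + z * (M * suc M * t) + z * M * N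
      expand = solve-∀
      regroup : ∀ z M N → suc M * (M * N) + z * N + z * M * N ≡ M * (suc M * N) + (z * M * N + z * N)
      regroup = solve-∀
      MM′t≤N : M * suc M * t ≤ N
      MM′t≤N = begin
        M * suc M * t       ≤⟨ *-monoˡ-≤ t (*-monoˡ-≤ (suc M) (n≤1+n M)) ⟩
        suc M * suc M * t   ≡⟨ *-comm (suc M * suc M) t ⟩
        t * (suc M * suc M) ≤⟨ m/n*n≤m N (suc M * suc M) ⟩
        N                   ∎

    ∑-inverse-squares : ∀ r → z * inverseSquares r ≤ N
    ∑-inverse-squares r = *-cancelˡ-≤ (z + r) {{>-nonZero (≤-trans 1≤z (m≤m+n z r))}} (begin
      (z + r) * (z * inverseSquares r)          ≡⟨ regroup z (z + r) (inverseSquares r) ⟩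
      z * (z + r) * inverseSquares r            ≤⟨ m≤m+n _ (z * N) ⟩
      z * (z + r) * inverseSquares r + z * N    ≤⟨ ∑-inverse-squares-telescope r ⟩
      (z + r) * N                               ∎)
      where open ≤-Reasoning
            regroup : ∀ z M S → M * (z * S) ≡ z * M * S
            regroup = solve-∀

  -- Arithmetic behind the density estimate: C counts squarefree values, T sieved values below N,
  -- a / A and c / B are the sieve densities at levels z and P, and w = 8 m.
  module _ (m N A a B c : ℕ) .{{_ : NonZero m}} .{{_ : NonZero A}} .{{_ : NonZero B}} where

    private
      w = 8 * m
      instance
        Aw-nonZero = m*n≢0 A w
        mB-nonZero = m*n≢0 m B

    upper-surplus : c ≤ B → 2 * m * a < N → 2 * m * N * c + m * w * B * a < w * B * N
    upper-surplus c≤B 2ma<N = begin-strict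
      2 * m * N * c + m * w * B * a       ≤⟨ +-monoˡ-≤ _ (*-monoʳ-≤ (2 * m * N) c≤B) ⟩
      2 * m * N * B + m * w * B * a       ≡⟨ regroup m N B a ⟩
      (m * B) * (2 * N + 4 * (2 * m * a)) <⟨ *-monoʳ-< (m * B) (+-monoʳ-< (2 * N) (*-monoʳ-< 4 2ma<N)) ⟩
      (m * B) * (2 * N + 4 * N)           ≤⟨ *-monoʳ-≤ (m * B) (≤-trans (≤-reflexive (collect N)) (m≤m+n (6 * N) (2 * N))) ⟩
      (m * B) * (6 * N + 2 * N)           ≡⟨ regroup′ m B N ⟩
      w * B * N                           ∎
      where
      open ≤-Reasoning
      regroup : ∀ m N B a → 2 * m * N * B + m * (8 * m) * B * a ≡ (m * B) * (2 * N + 4 * (2 * m * a))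
      regroup = solve-∀
      collect : ∀ N → 2 * N + 4 * N ≡ 6 * N
      collect = solve-∀
      regroup′ : ∀ m B N → (m * B) * (6 * N + 2 * N) ≡ (8 * m) * B * N
      regroup′ = solve-∀

    density-upper-estimate : ∀ C T → C ≤ T → A * T ≤ a * N + A * a → a * B * w ≤ c * A * (w + 2) →
      c ≤ B → 2 * m * a < N → m * C * B < (c * m + B) * N
    density-upper-estimate C T C≤T AT≤ ratio c≤B 2ma<N = *-cancelˡ-< (A * w) _ _ (begin-strict
      A * w * (m * C * B)                              ≤⟨ *-monoʳ-≤ (A * w) (*-monoˡ-≤ B (*-monoʳ-≤ m C≤T)) ⟩
      A * w * (m * T * B)                              ≡⟨ regroup₁ A w m T B ⟩
      m * w * B * (A * T)                              ≤⟨ *-monoʳ-≤ (m * w * B) AT≤ ⟩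
      m * w * B * (a * N + A * a)                      ≡⟨ regroup₂ m w B a N A ⟩
      m * N * (a * B * w) + m * w * B * A * a          ≤⟨ +-monoˡ-≤ _ (*-monoʳ-≤ (m * N) ratio) ⟩
      m * N * (c * A * (w + 2)) + m * w * B * A * a    ≡⟨ regroup₃ m N c A w B a ⟩
      A * (w * c * m * N) + A * (2 * m * N * c + m * w * B * a)
                                                       <⟨ +-monoʳ-< (A * (w * c * m * N)) (*-monoʳ-< A (upper-surplus c≤B 2ma<N)) ⟩
      A * (w * c * m * N) + A * (w * B * N)            ≡⟨ regroup₄ A w c m N B ⟩
      A * w * ((c * m + B) * N)                        ∎)
      where
      open ≤-Reasoning
      regroup₁ : ∀ A w m T B → A * w * (m * T * B) ≡ m * w * B * (A * T)
      regroup₁ = solve-∀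
      regroup₂ : ∀ m w B a N A → m * w * B * (a * N + A * a) ≡ m * N * (a * B * w) + m * w * B * A * a
      regroup₂ = solve-∀
      regroup₃ : ∀ m N c A w B a → m * N * (c * A * (w + 2)) + m * w * B * A * a ≡
                 A * (w * c * m * N) + A * (2 * m * N * c + m * w * B * a)
      regroup₃ = solve-∀
      regroup₄ : ∀ A w c m N B → A * (w * c * m * N) + A * (w * B * N) ≡ A * w * ((c * m + B) * N)
      regroup₄ = solve-∀

    sieved-lower : ∀ T → a * N ≤ A * T + A * a → c * A ≤ a * B → m * c * N ≤ m * B * (T + a)
    sieved-lower T aN≤ ratio = *-cancelˡ-≤ A (begin
      A * (m * c * N)         ≡⟨ regroup₁ A m c N ⟩
      m * N * (c * A)         ≤⟨ *-monoʳ-≤ (m * N) ratio ⟩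
      m * N * (a * B)         ≡⟨ regroup₂ m N a B ⟩
      m * B * (a * N)         ≤⟨ *-monoʳ-≤ (m * B) aN≤ ⟩
      m * B * (A * T + A * a) ≡⟨ regroup₃ m B A T a ⟩
      A * (m * B * (T + a))   ∎)
      where
      open ≤-Reasoning
      regroup₁ : ∀ A m c N → A * (m * c * N) ≡ m * N * (c * A)
      regroup₁ = solve-∀
      regroup₂ : ∀ m N a B → m * N * (a * B) ≡ m * B * (a * N)
      regroup₂ = solve-∀
      regroup₃ : ∀ m B A T a → m * B * (A * T + A * a) ≡ A * (m * B * (T + a))
      regroup₃ = solve-∀

    -- L counts the n whose value is divisible by p² for a prime z < p ≤ z + r.
    discarded-small : ∀ z r L → z * L ≤ 2 * N + 2 * z * r → 8 * z * r ≤ N → w ≤ z → 2 * m * a < N → m * (L + a) < N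
    discarded-small z r L zL≤ 8zr≤N w≤z 2ma<N = *-cancelˡ-< 32 _ _ (begin-strict
      32 * (m * (L + a))                         ≡⟨ regroup₁ m L a ⟩
      4 * (w * L) + 16 * (2 * m * a)             ≤⟨ +-monoˡ-≤ _ (*-monoʳ-≤ 4 (*-monoˡ-≤ L w≤z)) ⟩
      4 * (z * L) + 16 * (2 * m * a)             ≤⟨ +-monoˡ-≤ _ (*-monoʳ-≤ 4 zL≤) ⟩
      4 * (2 * N + 2 * z * r) + 16 * (2 * m * a) ≡⟨ regroup₂ N z r (2 * m * a) ⟩
      8 * N + 8 * z * r + 16 * (2 * m * a)       ≤⟨ +-monoˡ-≤ _ (+-monoʳ-≤ (8 * N) 8zr≤N) ⟩
      8 * N + N + 16 * (2 * m * a)               <⟨ +-monoʳ-< (8 * N + N) (*-monoʳ-< 16 2ma<N) ⟩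
      8 * N + N + 16 * N                         ≤⟨ ≤-trans (≤-reflexive (collect N)) (m≤m+n (25 * N) (7 * N)) ⟩
      25 * N + 7 * N                             ≡⟨ collect′ N ⟩
      32 * N                                     ∎)
      where
      open ≤-Reasoning
      regroup₁ : ∀ m L a → 32 * (m * (L + a)) ≡ 4 * (8 * m * L) + 16 * (2 * m * a)
      regroup₁ = solve-∀
      regroup₂ : ∀ N z r x → 4 * (2 * N + 2 * z * r) + 16 * x ≡ 8 * N + 8 * z * r + 16 * x
      regroup₂ = solve-∀
      collect : ∀ N → 8 * N + N + 16 * N ≡ 25 * N
      collect = solve-∀
      collect′ : ∀ N → 25 * N + 7 * N ≡ 32 * N
      collect′ = solve-∀

    density-lower-estimate : ∀ C T z r L → T ≤ C + L → z * L ≤ 2 * N + 2 * z * r → a * N ≤ A * T + A * a →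
      c * A ≤ a * B → 8 * z * r ≤ N → w ≤ z → 2 * m * a < N → m * c * N < (m * C + N) * B
    density-lower-estimate C T z r L T≤C+L zL≤ aN≤ ratio 8zr≤N w≤z 2ma<N = begin-strict
      m * c * N                     ≤⟨ sieved-lower T aN≤ ratio ⟩
      m * B * (T + a)               ≤⟨ *-monoʳ-≤ (m * B) (+-monoˡ-≤ a T≤C+L) ⟩
      m * B * (C + L + a)           ≡⟨ regroup m B C L a ⟩
      m * C * B + B * (m * (L + a)) <⟨ +-monoʳ-< (m * C * B) (*-monoʳ-< B (discarded-small z r L zL≤ 8zr≤N w≤z 2ma<N)) ⟩
      m * C * B + B * N             ≡⟨ regroup′ m C B N ⟩
      (m * C + N) * B               ∎
      where
      open ≤-Reasoning
      regroup : ∀ m B C L a → m * B * (C + L + a) ≡ m * C * B + B * (m * (L + a))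
      regroup = solve-∀
      regroup′ : ∀ m C B N → m * C * B + B * N ≡ (m * C + N) * B
      regroup′ = solve-∀

module Sieve where

  open import Data.Bool using (Bool; true; false; _∧_; _∨_; not; if_then_else_; T; T?)
  open import Data.Bool.Properties using (T-∧; T-∨)
  open import Data.Empty using (⊥; ⊥-elim)
  open import Data.Nat
  open import Data.Nat.Coprimality using (coprime-Bézout)
  import Data.Nat.Coprimality as Coprimality
  open import Data.Nat.Divisibility
  open import Data.Nat.DivMod using (m/n*n≤m; m*n/n≡m; /-monoˡ-≤)
  open import Data.Nat.Primality
  open import Data.Nat.Properties
  open import Data.Nat.Tactic.RingSolver using (solve-∀)
  open import Data.Product using (_×_; _,_; proj₁; proj₂)
  open import Data.Sum using (_⊎_; inj₁; inj₂)
  import Data.Sum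
  open import Function.Bundles using (_⇔_; mk⇔; Equivalence)
  open import Relation.Binary.PropositionalEquality
  open import Relation.Nullary using (¬_; does; yes; no)
  open import Relation.Nullary.Decidable using (dec-false; does-⇔; _⊎-dec_)
  open FiniteSum
  open Counting
  open Divisibility
  open LinearCongruence
  open EulerProduct
  open SieveBounds
  open import Defs using (SquareFree; squareFree?)

  record LinearFactorisation (k ℓ : ℕ) (f : ℕ → ℕ) : Set where
    field
      a₁ b₁ a₂ b₂ w : ℕ
      f-split      : ∀ n → f (suc n) ≡ (a₁ * n + b₁) * (a₂ * n + b₂)
      4∤f          : ∀ n → ¬ (2 * 2 ∣ f (suc n))
      resultant    : (a₂ * b₁ ≡ a₁ * b₂ + w) ⊎ (a₁ * b₂ ≡ a₂ * b₁ + w)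
      odd-prime∤w  : ∀ p → Prime p → p ≢ 2 → ¬ p ∣ w
      a₁∼k         : ∀ p → Prime p → p ≢ 2 → p ∣ a₁ ⇔ p ∣ k
      a₂∼ℓ         : ∀ p → Prime p → p ≢ 2 → p ∣ a₂ ⇔ p ∣ ℓ
      k⊥ℓ          : ∀ p → Prime p → p ≢ 2 → p ∣ k → p ∣ ℓ → ⊥

  module _ {k ℓ f} (L : LinearFactorisation k ℓ f) where

    open LinearFactorisation L

    -- Shifted by one, so that n < N here corresponds to 1 ≤ n ≤ N in sqfreeCount.
    g d₁ d₂ : ℕ → ℕ
    g  n = f (suc n)
    d₁ n = a₁ * n + b₁
    d₂ n = a₂ * n + b₂

    ∣-resultant : ∀ {p} c → p ∣ c + a₂ * b₁ → p ∣ c + a₁ * b₂ → p ∣ w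
    ∣-resultant {p} c p∣c+a₂b₁ p∣c+a₁b₂ with resultant
    ... | inj₁ a₂b₁≡ = ∣m+n∣m⇒∣n (subst (p ∣_) (trans (cong (c +_) a₂b₁≡) (sym (+-assoc c _ w))) p∣c+a₂b₁) p∣c+a₁b₂
    ... | inj₂ a₁b₂≡ = ∣m+n∣m⇒∣n (subst (p ∣_) (trans (cong (c +_) a₁b₂≡) (sym (+-assoc c _ w))) p∣c+a₁b₂) p∣c+a₂b₁

    odd-prime∤d₁∧d₂ : ∀ p → Prime p → p ≢ 2 → ∀ n → ¬ (p ∣ d₁ n × p ∣ d₂ n)
    odd-prime∤d₁∧d₂ p p-prime p≢2 n (p∣d₁ , p∣d₂) = odd-prime∤w p p-prime p≢2
      (∣-resultant (a₁ * a₂ * n) (subst (p ∣_) (expand a₂ a₁ n b₁) (∣n⇒∣m*n a₂ p∣d₁))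
                                (subst (p ∣_) (expand′ a₁ a₂ n b₂) (∣n⇒∣m*n a₁ p∣d₂)))
      where expand : ∀ a₂ a₁ n b₁ → a₂ * (a₁ * n + b₁) ≡ a₁ * a₂ * n + a₂ * b₁
            expand = solve-∀
            expand′ : ∀ a₁ a₂ n b₂ → a₁ * (a₂ * n + b₂) ≡ a₁ * a₂ * n + a₁ * b₂
            expand′ = solve-∀

    odd-prime∣a₁⇒∤b₁ : ∀ p → Prime p → p ≢ 2 → p ∣ a₁ → ¬ p ∣ b₁
    odd-prime∣a₁⇒∤b₁ p p-prime p≢2 p∣a₁ p∣b₁ =
      odd-prime∤w p p-prime p≢2 (∣-resultant 0 (∣n⇒∣m*n a₂ p∣b₁) (∣m⇒∣m*n b₂ p∣a₁))

    odd-prime∣a₂⇒∤b₂ : ∀ p → Prime p → p ≢ 2 → p ∣ a₂ → ¬ p ∣ b₂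
    odd-prime∣a₂⇒∤b₂ p p-prime p≢2 p∣a₂ p∣b₂ =
      odd-prime∤w p p-prime p≢2 (∣-resultant 0 (∣m⇒∣m*n b₁ p∣a₂) (∣n⇒∣m*n a₁ p∣b₂))

    square∣g : ℕ → ℕ → Bool
    square∣g p n = does (p * p ∣? g n)

    square∣d₁ square∣d₂ : ℕ → ℕ → Bool
    square∣d₁ p = isRoot (p * p) a₁ b₁
    square∣d₂ p = isRoot (p * p) a₂ b₂

    square∣g-split : ∀ p → Prime p → p ≢ 2 → ∀ n → square∣g p n ≡ square∣d₁ p n ∨ square∣d₂ p n
    square∣g-split p p-prime p≢2 n = does-⇔ (mk⇔ split merge) (p * p ∣? g n) (p * p ∣? d₁ n ⊎-dec p * p ∣? d₂ n)
      where
      split : p * p ∣ g n → p * p ∣ d₁ n ⊎ p * p ∣ d₂ n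
      split pp∣g = prime-square∣* p-prime (odd-prime∤d₁∧d₂ p p-prime p≢2 n) (subst (p * p ∣_) (f-split n) pp∣g)
      merge : p * p ∣ d₁ n ⊎ p * p ∣ d₂ n → p * p ∣ g n
      merge (inj₁ pp∣d₁) = subst (p * p ∣_) (sym (f-split n)) (∣m⇒∣m*n (d₂ n) pp∣d₁)
      merge (inj₂ pp∣d₂) = subst (p * p ∣_) (sym (f-split n)) (∣n⇒∣m*n (d₁ n) pp∣d₂)

    square∣d₁∧d₂-disjoint : ∀ p → Prime p → p ≢ 2 → ∀ n → T (square∣d₁ p n) → ¬ T (square∣d₂ p n)
    square∣d₁∧d₂-disjoint p p-prime p≢2 n pp∣d₁ pp∣d₂ = odd-prime∤d₁∧d₂ p p-prime p≢2 n
      (∣-trans (m∣m*n p) (T-does⇒ (p * p ∣? d₁ n) pp∣d₁) , ∣-trans (m∣m*n p) (T-does⇒ (p * p ∣? d₂ n) pp∣d₂))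

    count-square∣d₁ : ∀ p → Prime p → p ≢ 2 → count (square∣d₁ p) (p * p) ≡ (if does (p ∣? k) then 0 else 1)
    count-square∣d₁ p p-prime p≢2 with p ∣? k
    ... | yes p∣k = count-roots-none (m∣m*n p) p∣a₁ (odd-prime∣a₁⇒∤b₁ p p-prime p≢2 p∣a₁) (p * p)
      where p∣a₁ = Equivalence.from (a₁∼k p p-prime p≢2) p∣k
    ... | no  p∤k = count-roots {{m*n≢0 p p {{prime⇒nonZero p-prime}} {{prime⇒nonZero p-prime}}}}
                      (coprime-square (prime∤⇒coprime p-prime (λ p∣a₁ → p∤k (Equivalence.to (a₁∼k p p-prime p≢2) p∣a₁)))) b₁

    count-square∣d₂ : ∀ p → Prime p → p ≢ 2 → count (square∣d₂ p) (p * p) ≡ (if does (p ∣? ℓ) then 0 else 1)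
    count-square∣d₂ p p-prime p≢2 with p ∣? ℓ
    ... | yes p∣ℓ = count-roots-none (m∣m*n p) p∣a₂ (odd-prime∣a₂⇒∤b₂ p p-prime p≢2 p∣a₂) (p * p)
      where p∣a₂ = Equivalence.from (a₂∼ℓ p p-prime p≢2) p∣ℓ
    ... | no  p∤ℓ = count-roots {{m*n≢0 p p {{prime⇒nonZero p-prime}} {{prime⇒nonZero p-prime}}}}
                      (coprime-square (prime∤⇒coprime p-prime (λ p∣a₂ → p∤ℓ (Equivalence.to (a₂∼ℓ p p-prime p≢2) p∣a₂)))) b₂

    count-square∣g : ∀ p → Prime p → count (square∣g p) (p * p) ≡ ρ k ℓ p
    count-square∣g p p-prime with p ≟ 2
    ... | yes refl = count-none _ 4 (λ n _ 4∣g → 4∤f n (T-does⇒ (4 ∣? g n) 4∣g))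
    ... | no  p≢2  = begin
      count (square∣g p) (p * p)                                       ≡⟨ ∑-cong′ (p * p) (λ n → cong indicator (square∣g-split p p-prime p≢2 n)) ⟩
      count (λ n → square∣d₁ p n ∨ square∣d₂ p n) (p * p)              ≡⟨ count-∨-disjoint _ _ (p * p) (square∣d₁∧d₂-disjoint p p-prime p≢2) ⟩
      count (square∣d₁ p) (p * p) + count (square∣d₂ p) (p * p)        ≡⟨ cong₂ _+_ (count-square∣d₁ p p-prime p≢2) (count-square∣d₂ p p-prime p≢2) ⟩
      (if does (p ∣? k) then 0 else 1) + (if does (p ∣? ℓ) then 0 else 1) ≡⟨ roots-of-kℓ ⟩
      (if does (p ∣? k * ℓ) then 1 else 2)                             ≡⟨ cong (λ b → if b then 0 else (if does (p ∣? k * ℓ) then 1 else 2)) (sym (dec-false (p ≟ 2) p≢2)) ⟩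
      ρ k ℓ p                                                          ∎
      where
      open ≡-Reasoning
      roots-of-kℓ : (if does (p ∣? k) then 0 else 1) + (if does (p ∣? ℓ) then 0 else 1) ≡ (if does (p ∣? k * ℓ) then 1 else 2)
      roots-of-kℓ with p ∣? k | p ∣? ℓ | p ∣? k * ℓ
      ... | yes p∣k | yes p∣ℓ | _        = ⊥-elim (k⊥ℓ p p-prime p≢2 p∣k p∣ℓ)
      ... | yes _   | no  _   | yes _    = refl
      ... | yes p∣k | no  _   | no  p∤kℓ = ⊥-elim (p∤kℓ (∣m⇒∣m*n ℓ p∣k))
      ... | no  _   | yes _   | yes _    = refl
      ... | no  _   | yes p∣ℓ | no  p∤kℓ = ⊥-elim (p∤kℓ (∣n⇒∣m*n k p∣ℓ))
      ... | no  _   | no  _   | no  _    = refl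
      ... | no  p∤k | no  p∤ℓ | yes p∣kℓ with euclidsLemma k ℓ p-prime p∣kℓ
      ...   | inj₁ p∣k = ⊥-elim (p∤k p∣k)
      ...   | inj₂ p∣ℓ = ⊥-elim (p∤ℓ p∣ℓ)

    g-shift : ∀ n X → g (n + X) ≡ g n + X * (a₁ * d₂ n + a₂ * d₁ n + a₁ * a₂ * X)
    g-shift n X = trans (f-split (n + X)) (trans (expand a₁ b₁ a₂ b₂ n X) (cong (_+ X * (a₁ * d₂ n + a₂ * d₁ n + a₁ * a₂ * X)) (sym (f-split n))))
      where expand : ∀ a₁ b₁ a₂ b₂ n X → (a₁ * (n + X) + b₁) * (a₂ * (n + X) + b₂) ≡
                       (a₁ * n + b₁) * (a₂ * n + b₂) + X * (a₁ * (a₂ * n + b₂) + a₂ * (a₁ * n + b₁) + a₁ * a₂ * X)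
            expand = solve-∀

    square∣g-periodic : ∀ p X → p * p ∣ X → ∀ n → square∣g p (n + X) ≡ square∣g p n
    square∣g-periodic p X pp∣X n = does-⇔ (mk⇔ drop add) (p * p ∣? g (n + X)) (p * p ∣? g n)
      where
      pp∣shift = ∣m⇒∣m*n (a₁ * d₂ n + a₂ * d₁ n + a₁ * a₂ * X) pp∣X
      drop : p * p ∣ g (n + X) → p * p ∣ g n
      drop pp∣ = ∣m+n∣m⇒∣n (subst (p * p ∣_) (trans (g-shift n X) (+-comm (g n) _)) pp∣) pp∣shift
      add : p * p ∣ g n → p * p ∣ g (n + X)
      add pp∣ = subst (p * p ∣_) (sym (g-shift n X)) (∣m∣n⇒∣m+n pp∣ pp∣shift)

    sieved : ℕ → ℕ → Bool
    sieved zero    n = true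
    sieved (suc z) n = if does (prime? (suc z)) then sieved z n ∧ not (square∣g (suc z) n) else sieved z n

    sieved-periodic : ∀ z X → primorial² z ∣ X → ∀ n → sieved z (n + X) ≡ sieved z n
    sieved-periodic zero    X _     n = refl
    sieved-periodic (suc z) X Q∣X n with prime? (suc z)
    ... | no  _ = sieved-periodic z X Q∣X n
    ... | yes _ = cong₂ _∧_ (sieved-periodic z X (∣-trans (m∣m*n _) Q∣X) n)
                            (cong not (square∣g-periodic (suc z) X (∣-trans (n∣m*n (primorial² z)) Q∣X) n))

    count-sieved : ∀ z → count (sieved z) (primorial² z) ≡ unsieved (ρ k ℓ) z
    count-sieved zero    = refl
    count-sieved (suc z) with prime? (suc z)
    ... | no  _       = count-sieved z
    ... | yes p-prime = begin
      count (λ n → sieved z n ∧ not (square∣g p n)) (Q * (p * p))   ≡⟨ cong (count _) (*-comm Q (p * p)) ⟩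
      count (λ n → sieved z n ∧ not (square∣g p n)) (p * p * Q)     ≡⟨ ∑-cong′ (p * p * Q) (λ n → indicator-∧ (sieved z n) (not (square∣g p n))) ⟩
      ∑[ n < p * p * Q ] (indicator (sieved z n) * indicator (not (square∣g p n)))
        ≡⟨ ∑-periodic-product (λ n → cong indicator (sieved-periodic z Q ∣-refl n))
                              (λ n → cong (λ b → indicator (not b)) (square∣g-periodic p (p * p) ∣-refl n))
                              (coprime-Bézout (Coprimality.sym (coprime-square (prime∤⇒coprime p-prime (prime∤primorial² p-prime z ≤-refl))))) ⟩
      count (sieved z) Q * count (λ n → not (square∣g p n)) (p * p)  ≡⟨ cong₂ _*_ (count-sieved z) count-complement ⟩
      unsieved (ρ k ℓ) z * (p * p ∸ ρ k ℓ p)                          ∎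
      where
      open ≡-Reasoning
      p = suc z
      Q = primorial² z
      instance
        Q-nonZero  = primorial²-nonZero z
        pp-nonZero = m*n≢0 p p
      count-complement : count (λ n → not (square∣g p n)) (p * p) ≡ p * p ∸ ρ k ℓ p
      count-complement = trans (sym (m+n∸n≡m _ (count (square∣g p) (p * p))))
                               (cong₂ _∸_ (count-not (square∣g p) (p * p)) (count-square∣g p p-prime))


    squarefree : ℕ → Bool
    squarefree n = does (squareFree? (g n))

    sieved⇒no-small-square : ∀ z n → T (sieved z n) → ∀ p → Prime p → p ≤ z → ¬ p * p ∣ g n
    sieved⇒no-small-square zero    n _  p p-prime p≤0 = ⊥-elim (¬prime[0] (subst Prime (n≤0⇒n≡0 p≤0) p-prime))
    sieved⇒no-small-square (suc z) n sv p p-prime p≤1+z with prime? (suc z) | p ≟ suc z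
    ... | no ¬prime | yes refl = ⊥-elim (¬prime p-prime)
    ... | no _      | no p≢1+z = sieved⇒no-small-square z n sv p p-prime (≤-pred (≤∧≢⇒< p≤1+z p≢1+z))
    ... | yes _     | yes refl = T-not-does⇒ (p * p ∣? g n) (proj₂ (Equivalence.to T-∧ sv))
    ... | yes _     | no p≢1+z = sieved⇒no-small-square z n (proj₁ (Equivalence.to T-∧ sv)) p p-prime (≤-pred (≤∧≢⇒< p≤1+z p≢1+z))

    squarefree⇒sieved : ∀ z n → SquareFree (g n) → T (sieved z n)
    squarefree⇒sieved zero    n sf = _
    squarefree⇒sieved (suc z) n sf with prime? (suc z)
    ... | no  _       = squarefree⇒sieved z n sf
    ... | yes p-prime = Equivalence.from T-∧ (squarefree⇒sieved z n sf , ⇒T-not-does (_ ∣? g n) (sf (suc z) p-prime))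

    count-squarefree≤sieved : ∀ z N → count squarefree N ≤ count (sieved z) N
    count-squarefree≤sieved z N = count-mono squarefree (sieved z) N
      (λ n _ sf → squarefree⇒sieved z n (T-does⇒ (squareFree? (g n)) sf))

    primeSquare∣d : ℕ → ℕ → Bool
    primeSquare∣d j n = does (prime? j) ∧ (square∣d₁ j n ∨ square∣d₂ j n)

    largePrimeSquare∣d : ℕ → ℕ → ℕ → Bool
    largePrimeSquare∣d z zero    n = false
    largePrimeSquare∣d z (suc r) n = largePrimeSquare∣d z r n ∨ primeSquare∣d (suc z + r) n

    largePrimeSquare∣d-intro : ∀ z r i n → i < r → T (primeSquare∣d (suc z + i) n) → T (largePrimeSquare∣d z r n)
    largePrimeSquare∣d-intro z (suc r) i n i<1+r witness with i ≟ r
    ... | yes refl = Equivalence.from (T-∨ {largePrimeSquare∣d z r n}) (inj₂ witness)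
    ... | no  i≢r  = Equivalence.from T-∨ (inj₁ (largePrimeSquare∣d-intro z r i n (≤∧≢⇒< (≤-pred i<1+r) i≢r) witness))

    count-largePrimeSquare∣d : ∀ z r N →
      count (largePrimeSquare∣d z r) N ≤ ∑[ i < r ] count (primeSquare∣d (suc z + i)) N
    count-largePrimeSquare∣d z zero    N = ≤-reflexive (count-none _ N (λ _ _ ()))
    count-largePrimeSquare∣d z (suc r) N = ≤-trans (count-∨ (largePrimeSquare∣d z r) (primeSquare∣d (suc z + r)) N)
                                                   (+-monoˡ-≤ _ (count-largePrimeSquare∣d z r N))

    count-roots-bound : ∀ j a b → Prime (suc j) → (suc j ∣ a → ¬ suc j ∣ b) → ∀ N →
      count (isRoot (suc j * suc j) a b) N ≤ N / (suc j * suc j) + 1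
    count-roots-bound j a b p-prime p∣a⇒p∤b N with suc j ∣? a
    ... | yes p∣a = ≤-trans (≤-reflexive (count-roots-none (m∣m*n (suc j)) p∣a (p∣a⇒p∤b p∣a) N)) z≤n
    ... | no  p∤a = count-spaced (roots-spaced (coprime-square (prime∤⇒coprime p-prime p∤a)) b) N

    count-primeSquare∣d : ∀ j N → 3 ≤ suc j → count (primeSquare∣d (suc j)) N ≤ 2 * (N / (suc j * suc j) + 1)
    count-primeSquare∣d j N 3≤p with prime? (suc j)
    ... | no  _       = ≤-trans (≤-reflexive (count-none _ N (λ _ _ ()))) z≤n
    ... | yes p-prime = begin
      count (λ n → square∣d₁ p n ∨ square∣d₂ p n) N       ≤⟨ count-∨ (square∣d₁ p) (square∣d₂ p) N ⟩
      count (square∣d₁ p) N + count (square∣d₂ p) N        ≤⟨ +-mono-≤ (count-roots-bound j a₁ b₁ p-prime (odd-prime∣a₁⇒∤b₁ p p-prime p≢2) N)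
                                                                        (count-roots-bound j a₂ b₂ p-prime (odd-prime∣a₂⇒∤b₂ p p-prime p≢2) N) ⟩
      (N / (p * p) + 1) + (N / (p * p) + 1)                ≡⟨ cong ((N / (p * p) + 1) +_) (sym (+-identityʳ _)) ⟩
      2 * (N / (p * p) + 1)                                ∎
      where
      open ≤-Reasoning
      p = suc j
      p≢2 : p ≢ 2
      p≢2 p≡2 = <⇒≢ 3≤p (sym p≡2)

    count-largePrimeSquare∣d-bound : ∀ z r N → 2 ≤ z → z * count (largePrimeSquare∣d z r) N ≤ 2 * N + 2 * z * r
    count-largePrimeSquare∣d-bound z r N 2≤z = begin
      z * count (largePrimeSquare∣d z r) N                      ≤⟨ *-monoʳ-≤ z (count-largePrimeSquare∣d z r N) ⟩
      z * ∑[ i < r ] count (primeSquare∣d (suc z + i)) N        ≤⟨ *-monoʳ-≤ z (∑-mono-≤ r (λ i _ → count-primeSquare∣d (z + i) N (s≤s (≤-trans 2≤z (m≤m+n z i))))) ⟩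
      z * ∑[ i < r ] (2 * (N / (q i * q i) + 1))                ≡⟨ cong (z *_) (trans (∑-*-distribˡ 2 _ r) (cong (2 *_) (∑-distrib-+ _ _ r))) ⟩
      z * (2 * (S + ∑[ _ < r ] 1))                              ≡⟨ cong (λ x → z * (2 * (S + x))) (trans (∑-const 1 r) (*-identityʳ r)) ⟩
      z * (2 * (S + r))                                         ≡⟨ expand z S r ⟩
      2 * (z * S) + 2 * z * r                                   ≤⟨ +-monoˡ-≤ (2 * z * r) (*-monoʳ-≤ 2 (∑-inverse-squares z N (≤-trans (s≤s z≤n) 2≤z) r)) ⟩
      2 * N + 2 * z * r                                         ∎
      where
      open ≤-Reasoning
      q : ℕ → ℕ
      q i = suc z + i
      S = ∑[ i < r ] (N / (q i * q i))
      expand : ∀ z S r → z * (2 * (S + r)) ≡ 2 * (z * S) + 2 * z * r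
      expand = solve-∀

    K : ℕ
    K = a₁ + b₁ + a₂ + b₂

    linear-bound : ∀ a b {n N} → n < N → a * n + b ≤ (a + b) * N
    linear-bound a b {n} {N} n<N = begin
      a * n + b     ≤⟨ +-mono-≤ (*-monoʳ-≤ a (<⇒≤ n<N)) (m≤m*n b N {{>-nonZero (≤-<-trans z≤n n<N)}}) ⟩
      a * N + b * N ≡⟨ sym (*-distribʳ-+ N a b) ⟩
      (a + b) * N   ∎
      where open ≤-Reasoning

    square∣d⇒≤KN : ∀ {N n p} → n < N → p * p ∣ d₁ n ⊎ p * p ∣ d₂ n → p * p ≤ K * N
    square∣d⇒≤KN {N} {n} n<N (inj₁ pp∣d₁) = begin
      _               ≤⟨ ∣⇒≤ {{≢-nonZero d₁≢0}} pp∣d₁ ⟩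
      d₁ n            ≤⟨ linear-bound a₁ b₁ n<N ⟩
      (a₁ + b₁) * N   ≤⟨ *-monoˡ-≤ N (≤-trans (m≤m+n (a₁ + b₁) a₂) (m≤m+n _ b₂)) ⟩
      K * N           ∎
      where open ≤-Reasoning
            d₁≢0 : d₁ n ≢ 0
            d₁≢0 d₁≡0 = 4∤f n (subst (4 ∣_) (sym (trans (f-split n) (cong (_* d₂ n) d₁≡0))) (divides 0 refl))
    square∣d⇒≤KN {N} {n} n<N (inj₂ pp∣d₂) = begin
      _               ≤⟨ ∣⇒≤ {{≢-nonZero d₂≢0}} pp∣d₂ ⟩
      d₂ n            ≤⟨ linear-bound a₂ b₂ n<N ⟩
      (a₂ + b₂) * N   ≤⟨ *-monoˡ-≤ N (≤-trans (m≤n+m (a₂ + b₂) (a₁ + b₁)) (≤-reflexive (sym (+-assoc (a₁ + b₁) a₂ b₂)))) ⟩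
      K * N           ∎
      where open ≤-Reasoning
            d₂≢0 : d₂ n ≢ 0
            d₂≢0 d₂≡0 = 4∤f n (subst (4 ∣_) (sym (trans (f-split n) (trans (cong (d₁ n *_) d₂≡0) (*-zeroʳ (d₁ n))))) (divides 0 refl))

    ≤KN⇒≤N/t : ∀ N t p .{{_ : NonZero t}} → K * t * t ≤ N → p * p ≤ K * N → p ≤ N / t
    ≤KN⇒≤N/t N t p Ktt≤N pp≤KN = subst (_≤ N / t) (m*n/n≡m p t) (/-monoˡ-≤ t pt≤N)
      where
      open ≤-Reasoning
      [pt]²≤N² : (p * t) * (p * t) ≤ N * N
      [pt]²≤N² = begin
        (p * t) * (p * t) ≡⟨ regroup p t ⟩
        (p * p) * (t * t) ≤⟨ *-monoˡ-≤ (t * t) pp≤KN ⟩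
        K * N * (t * t)   ≡⟨ regroup′ K N t ⟩
        K * t * t * N     ≤⟨ *-monoˡ-≤ N Ktt≤N ⟩
        N * N             ∎
        where regroup : ∀ p t → (p * t) * (p * t) ≡ (p * p) * (t * t)
              regroup = solve-∀
              regroup′ : ∀ K N t → K * N * (t * t) ≡ K * t * t * N
              regroup′ = solve-∀
      pt≤N : p * t ≤ N
      pt≤N = ≮⇒≥ (λ N<pt → <⇒≱ (*-mono-< N<pt N<pt) [pt]²≤N²)

    module _ (z r N : ℕ) (2≤z : 2 ≤ z) (small : ∀ p → p * p ≤ K * N → p ≤ z + r) where

      sieved∧¬large⇒squarefree : ∀ n → n < N → T (sieved z n) → ¬ T (largePrimeSquare∣d z r n) → SquareFree (g n)
      sieved∧¬large⇒squarefree n n<N sv ¬large p p-prime pp∣g with p ≤? z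
      ... | yes p≤z = sieved⇒no-small-square z n sv p p-prime p≤z pp∣g
      ... | no  p≰z = ¬large (largePrimeSquare∣d-intro z r i n i<r (subst (λ j → T (primeSquare∣d j n)) (sym 1+z+i≡p) large))
        where
        z<p = ≰⇒> p≰z
        p≢2 : p ≢ 2
        p≢2 refl = <⇒≱ z<p 2≤z
        split : p * p ∣ d₁ n ⊎ p * p ∣ d₂ n
        split = prime-square∣* p-prime (odd-prime∤d₁∧d₂ p p-prime p≢2 n) (subst (p * p ∣_) (f-split n) pp∣g)
        i = p ∸ suc z
        1+z+i≡p : suc z + i ≡ p
        1+z+i≡p = m+[n∸m]≡n z<p
        i<r : i < r
        i<r = +-cancelˡ-< (suc z) i r (subst (_< suc z + r) (sym 1+z+i≡p) (s≤s (small p (square∣d⇒≤KN {p = p} n<N split))))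
        large : T (primeSquare∣d p n)
        large = Equivalence.from T-∧ (⇒T-does (prime? p) p-prime , Equivalence.from T-∨ (Data.Sum.map (⇒T-does (_ ∣? d₁ n)) (⇒T-does (_ ∣? d₂ n)) split))

      count-sieved≤squarefree+large : count (sieved z) N ≤ count squarefree N + count (largePrimeSquare∣d z r) N
      count-sieved≤squarefree+large = ≤-trans (count-mono (sieved z) (λ n → squarefree n ∨ largePrimeSquare∣d z r n) N squarefree∨large)
                                              (count-∨ squarefree (largePrimeSquare∣d z r) N)
        where
        squarefree∨large : ∀ n → n < N → T (sieved z n) → T (squarefree n ∨ largePrimeSquare∣d z r n)
        squarefree∨large n n<N sv with T? (largePrimeSquare∣d z r n)
        ... | yes large = Equivalence.from (T-∨ {squarefree n}) (inj₂ large)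
        ... | no ¬large = Equivalence.from T-∨ (inj₁ (⇒T-does (squareFree? (g n)) (sieved∧¬large⇒squarefree n n<N sv ¬large)))

    ρ≤2 : ∀ p → ρ k ℓ p ≤ 2
    ρ≤2 p = ≤-trans (ρ≤ρ₂ k ℓ p) (ρ₂≤2 p)

    -- Sieve by the primes up to z = 8m + 1; primes p with p² ≤ K N beyond z are at most z + N / (8z).
    module _ (m′ : ℕ) where

      private
        m = suc m′
        z = suc (8 * m)
        t = 8 * z
        A = primorial² z
        a = unsieved (ρ k ℓ) z
        instance
          A-nonZero = primorial²-nonZero z

      threshold : ℕ
      threshold = K * t * t + 2 * m * A + 1

      module _ (N P : ℕ) (threshold≤N : threshold ≤ N) (z≤P : z ≤ P) where

        private
          B = primorial² P
          c = unsieved (ρ k ℓ) P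
          r = N / t
          C = count squarefree N
          S = count (sieved z) N
          instance
            B-nonZero = primorial²-nonZero P
          P≡z+d : z + (P ∸ z) ≡ P
          P≡z+d = m+[n∸m]≡n z≤P
          Ktt≤N : K * t * t ≤ N
          Ktt≤N = ≤-trans (≤-trans (m≤m+n (K * t * t) (2 * m * A)) (m≤m+n _ 1)) threshold≤N
          2ma<N : 2 * m * a < N
          2ma<N = ≤-<-trans (*-monoʳ-≤ (2 * m) (unsieved≤primorial² (ρ k ℓ) z))
                    (≤-trans (≤-reflexive (+-comm 1 (2 * m * A))) (≤-trans (+-monoˡ-≤ 1 (m≤n+m (2 * m * A) (K * t * t))) threshold≤N))
          small : ∀ p → p * p ≤ K * N → p ≤ z + r
          small p pp≤KN = ≤-trans (≤KN⇒≤N/t N t p Ktt≤N pp≤KN) (m≤n+m r z)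
          sieved-periodic′ : Periodic (λ n → indicator (sieved z n)) A
          sieved-periodic′ n = cong indicator (sieved-periodic z A ∣-refl n)
          AS≤ : A * S ≤ a * N + A * a
          AS≤ = subst (λ x → A * S ≤ x * N + A * x) (count-sieved z) (∑-periodic-upper sieved-periodic′ N)
          aN≤ : a * N ≤ A * S + A * a
          aN≤ = subst (λ x → x * N ≤ A * S + A * x) (count-sieved z) (∑-periodic-lower sieved-periodic′ N)
          cA≤aB : c * A ≤ a * B
          cA≤aB = subst (λ P → unsieved (ρ k ℓ) P * A ≤ a * primorial² P) P≡z+d
                    (∏-primes-ratio-antitone (λ p → m∸n≤m (p * p) (ρ k ℓ p)) z (P ∸ z))
          tail : a * B * (8 * m) ≤ c * A * (8 * m + 2)
          tail = subst (λ P → a * primorial² P * (8 * m) ≤ unsieved (ρ k ℓ) P * A * (8 * m + 2)) P≡z+d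
                   (unsieved-tail (ρ k ℓ) (λ p _ → ρ≤2 p) (8 * m) (s≤s z≤n) (P ∸ z))

        density-upper : m * C * B < (c * m + B) * N
        density-upper = density-upper-estimate m N A a B c C S (count-squarefree≤sieved z N) AS≤ tail
                          (unsieved≤primorial² (ρ k ℓ) P) 2ma<N

        density-lower : m * c * N < (m * C + N) * B
        density-lower = density-lower-estimate m N A a B c C S z r (count (largePrimeSquare∣d z r) N)
                          (count-sieved≤squarefree+large z r N (s≤s (s≤s z≤n)) small)
                          (count-largePrimeSquare∣d-bound z r N (s≤s (s≤s z≤n)))
                          aN≤ cA≤aB (≤-trans (≤-reflexive (*-comm t r)) (m/n*n≤m N t)) (n≤1+n _) 2ma<N

module Fraction where

  open import Data.Integer as ℤ using (+_; +[1+_]; -[1+_])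
  import Data.Integer.Properties as ℤP
  open import Data.Nat as ℕ using (ℕ; suc; NonZero)
  open import Data.Nat.Tactic.RingSolver using (solve-∀)
  import Data.Nat.Properties as ℕP
  open import Data.Product using (Σ-syntax; _,_)
  open import Data.Rational using (mkℚ; _/_; toℚᵘ; _+_; _*_; _-_; -_; _<_; _≤_; 0ℚ; ∣_∣; *<*)
  import Data.Rational.Properties as ℚP
  open import Data.Rational.Unnormalised as ℚᵘ using (mkℚᵘ; *≡*; *≤*)
  import Data.Rational.Unnormalised.Properties as ℚᵘP
  open import Data.Sum using (inj₁; inj₂)
  open import Algebra.Properties.Group ℚP.+-0-group using (⁻¹-anti-homo-//)
  open import Relation.Binary.PropositionalEquality

  private
    +*+ : ∀ m n → + m ℤ.* + n ≡ + (m ℕ.* n)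
    +*+ m n = ℤP.+◃n≡+n (m ℕ.* n)

    toℚᵘ-/ : ∀ a b′ → toℚᵘ (+ a / suc b′) ℚᵘ.≃ mkℚᵘ (+ a) b′
    toℚᵘ-/ a b′ = ℚP.toℚᵘ-fromℚᵘ (mkℚᵘ (+ a) b′)

  /-cong : ∀ a b c d .{{_ : NonZero b}} .{{_ : NonZero d}} → a ℕ.* d ≡ c ℕ.* b → + a / b ≡ + c / d
  /-cong a (suc b′) c (suc d′) ad≡cb = ℚP.toℚᵘ-injective (ℚᵘP.≃-trans (toℚᵘ-/ a b′)
    (ℚᵘP.≃-trans (*≡* (trans (+*+ a (suc d′)) (trans (cong +_ ad≡cb) (sym (+*+ c (suc b′))))))
    (ℚᵘP.≃-sym (toℚᵘ-/ c d′))))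

  /-mono-< : ∀ a b c d .{{_ : NonZero b}} .{{_ : NonZero d}} → a ℕ.* d ℕ.< c ℕ.* b → + a / b < + c / d
  /-mono-< a (suc b′) c (suc d′) ad<cb = ℚP.toℚᵘ-cancel-<
    (ℚᵘP.<-respˡ-≃ (ℚᵘP.≃-sym (toℚᵘ-/ a b′)) (ℚᵘP.<-respʳ-≃ (ℚᵘP.≃-sym (toℚᵘ-/ c d′))
    (ℚᵘ.*<* (subst₂ ℤ._<_ (sym (+*+ a (suc d′))) (sym (+*+ c (suc b′))) (ℤ.+<+ ad<cb)))))

  /-mono-≤ : ∀ a b c d .{{_ : NonZero b}} .{{_ : NonZero d}} → a ℕ.* d ℕ.≤ c ℕ.* b → + a / b ≤ + c / d
  /-mono-≤ a (suc b′) c (suc d′) ad≤cb = ℚP.toℚᵘ-cancel-≤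
    (ℚᵘP.≤-respˡ-≃ (ℚᵘP.≃-sym (toℚᵘ-/ a b′)) (ℚᵘP.≤-respʳ-≃ (ℚᵘP.≃-sym (toℚᵘ-/ c d′))
    (*≤* (subst₂ ℤ._≤_ (sym (+*+ a (suc d′))) (sym (+*+ c (suc b′))) (ℤ.+≤+ ad≤cb)))))

  /-*-/ : ∀ a b c d .{{_ : NonZero b}} .{{_ : NonZero d}} →
    (+ a / b) * (+ c / d) ≡ (+ (a ℕ.* c) / (b ℕ.* d)) {{ℕP.m*n≢0 b d}}
  /-*-/ a (suc b′) c (suc d′) = ℚP.toℚᵘ-injective
    (ℚᵘP.≃-trans (ℚP.toℚᵘ-homo-* (+ a / suc b′) (+ c / suc d′))
    (ℚᵘP.≃-trans (ℚᵘP.*-cong (toℚᵘ-/ a b′) (toℚᵘ-/ c d′))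
    (ℚᵘP.≃-trans (ℚᵘP.≃-reflexive (cong (λ n → mkℚᵘ n (d′ ℕ.+ b′ ℕ.* suc d′)) (+*+ a c)))
    (ℚᵘP.≃-sym (toℚᵘ-/ (a ℕ.* c) (d′ ℕ.+ b′ ℕ.* suc d′))))))

  /-+-/ : ∀ a b c d .{{_ : NonZero b}} .{{_ : NonZero d}} →
    (+ a / b) + (+ c / d) ≡ (+ (a ℕ.* d ℕ.+ c ℕ.* b) / (b ℕ.* d)) {{ℕP.m*n≢0 b d}}
  /-+-/ a (suc b′) c (suc d′) = ℚP.toℚᵘ-injective
    (ℚᵘP.≃-trans (ℚP.toℚᵘ-homo-+ (+ a / suc b′) (+ c / suc d′))
    (ℚᵘP.≃-trans (ℚᵘP.+-cong (toℚᵘ-/ a b′) (toℚᵘ-/ c d′))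
    (ℚᵘP.≃-trans (ℚᵘP.≃-reflexive (cong (λ n → mkℚᵘ n (d′ ℕ.+ b′ ℕ.* suc d′))
        (trans (cong₂ ℤ._+_ (+*+ a (suc d′)) (+*+ c (suc b′))) (sym (ℤP.pos-+ (a ℕ.* suc d′) (c ℕ.* suc b′))))))
    (ℚᵘP.≃-sym (toℚᵘ-/ (a ℕ.* suc d′ ℕ.+ c ℕ.* suc b′) (d′ ℕ.+ b′ ℕ.* suc d′))))))

  positive⇒/ : ∀ ε → 0ℚ < ε → Σ[ u ∈ ℕ ] Σ[ d ∈ ℕ ] ε ≡ + suc u / suc d
  positive⇒/ (mkℚ +[1+ u ] d c) _ = u , d , sym (ℚP.fromℚᵘ-toℚᵘ (mkℚ +[1+ u ] d c))
  positive⇒/ (mkℚ (+ 0) d c) (*<* (ℤ.+<+ ()))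
  positive⇒/ (mkℚ -[1+ n ] d c) (*<* ())

  private
    <+⇒-< : ∀ x y e → x < e + y → x - y < e
    <+⇒-< x y e x<e+y = subst (x - y <_)
      (trans (ℚP.+-assoc e y (- y)) (trans (cong (λ q → e + q) (ℚP.+-inverseʳ y)) (ℚP.+-identityʳ e)))
      (ℚP.+-monoˡ-< (- y) x<e+y)

  ∣-∣<-intro : ∀ x y e → x < e + y → y < e + x → ∣ x - y ∣ < e
  ∣-∣<-intro x y e x<e+y y<e+x with ℚP.∣p∣≡p∨∣p∣≡-p (x - y)
  ... | inj₁ ∣x-y∣≡x-y  = subst (_< e) (sym ∣x-y∣≡x-y) (<+⇒-< x y e x<e+y)
  ... | inj₂ ∣x-y∣≡-x-y = subst (_< e) (sym (trans ∣x-y∣≡-x-y (⁻¹-anti-homo-// x y))) (<+⇒-< y x e y<e+x)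

  -- Cross-multiplied, the hypotheses say ∣ C / N - c / B ∣ < 1 / (m + 1).
  ∣-∣<-cross : ∀ C N c B u m .{{_ : NonZero B}} → let s = suc m in
    s ℕ.* C ℕ.* B ℕ.< (c ℕ.* s ℕ.+ B) ℕ.* N → s ℕ.* c ℕ.* N ℕ.< (s ℕ.* C ℕ.+ N) ℕ.* B →
    ∣ (+ C / 1) - (+ c / B) * (+ N / 1) ∣ < (+ suc u / suc m) * (+ N / 1)
  ∣-∣<-cross C N c B u m upper lower = subst₂ (λ y e → ∣ x - y ∣ < e)
    (sym (/-*-/ c B N 1)) (sym (/-*-/ (suc u) (suc m) N 1))
    (∣-∣<-intro x y e x<e+y y<e+x)
    where
    open ℕP.≤-Reasoning
    s = suc m
    t = suc u
    x = + C / 1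
    y = (+ (c ℕ.* N) / (B ℕ.* 1)) {{ℕP.m*n≢0 B 1}}
    e = + (t ℕ.* N) / (s ℕ.* 1)
    x<e+y : x < e + y
    x<e+y = subst (x <_) (sym (/-+-/ (t ℕ.* N) (s ℕ.* 1) (c ℕ.* N) (B ℕ.* 1) {{_}} {{ℕP.m*n≢0 B 1}}))
      (/-mono-< C 1 (t ℕ.* N ℕ.* (B ℕ.* 1) ℕ.+ c ℕ.* N ℕ.* (s ℕ.* 1)) (s ℕ.* 1 ℕ.* (B ℕ.* 1)) {{_}} {{ℕP.m*n≢0 (s ℕ.* 1) (B ℕ.* 1) {{_}} {{ℕP.m*n≢0 B 1}}}} (begin-strict
        C ℕ.* (s ℕ.* 1 ℕ.* (B ℕ.* 1))                   ≡⟨ regroup C s B ⟩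
        s ℕ.* C ℕ.* B                                   <⟨ upper ⟩
        (c ℕ.* s ℕ.+ B) ℕ.* N                           ≡⟨ regroup′ c s B N ⟩
        c ℕ.* N ℕ.* s ℕ.+ N ℕ.* B                       ≤⟨ ℕP.+-monoʳ-≤ (c ℕ.* N ℕ.* s) (ℕP.*-monoˡ-≤ B (ℕP.m≤n*m N t)) ⟩
        c ℕ.* N ℕ.* s ℕ.+ t ℕ.* N ℕ.* B                 ≡⟨ regroup″ c N s t B ⟩
        (t ℕ.* N ℕ.* (B ℕ.* 1) ℕ.+ c ℕ.* N ℕ.* (s ℕ.* 1)) ℕ.* 1 ∎))
      where regroup : ∀ C s B → C ℕ.* (s ℕ.* 1 ℕ.* (B ℕ.* 1)) ≡ s ℕ.* C ℕ.* B
            regroup = solve-∀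
            regroup′ : ∀ c s B N → (c ℕ.* s ℕ.+ B) ℕ.* N ≡ c ℕ.* N ℕ.* s ℕ.+ N ℕ.* B
            regroup′ = solve-∀
            regroup″ : ∀ c N s t B → c ℕ.* N ℕ.* s ℕ.+ t ℕ.* N ℕ.* B ≡ (t ℕ.* N ℕ.* (B ℕ.* 1) ℕ.+ c ℕ.* N ℕ.* (s ℕ.* 1)) ℕ.* 1
            regroup″ = solve-∀
    y<e+x : y < e + x
    y<e+x = subst (y <_) (sym (/-+-/ (t ℕ.* N) (s ℕ.* 1) C 1))
      (/-mono-< (c ℕ.* N) (B ℕ.* 1) (t ℕ.* N ℕ.* 1 ℕ.+ C ℕ.* (s ℕ.* 1)) (s ℕ.* 1 ℕ.* 1) {{ℕP.m*n≢0 B 1}} {{ℕP.m*n≢0 (s ℕ.* 1) 1}} (begin-strict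
        c ℕ.* N ℕ.* (s ℕ.* 1 ℕ.* 1)                     ≡⟨ regroup c N s ⟩
        s ℕ.* c ℕ.* N                                   <⟨ lower ⟩
        (s ℕ.* C ℕ.+ N) ℕ.* B                           ≤⟨ ℕP.*-monoˡ-≤ B (ℕP.+-monoʳ-≤ (s ℕ.* C) (ℕP.m≤n*m N t)) ⟩
        (s ℕ.* C ℕ.+ t ℕ.* N) ℕ.* B                     ≡⟨ regroup′ s C t N B ⟩
        (t ℕ.* N ℕ.* 1 ℕ.+ C ℕ.* (s ℕ.* 1)) ℕ.* (B ℕ.* 1) ∎))
      where regroup : ∀ c N s → c ℕ.* N ℕ.* (s ℕ.* 1 ℕ.* 1) ≡ s ℕ.* c ℕ.* N
            regroup = solve-∀
            regroup′ : ∀ s C t N B → (s ℕ.* C ℕ.+ t ℕ.* N) ℕ.* B ≡ (t ℕ.* N ℕ.* 1 ℕ.+ C ℕ.* (s ℕ.* 1)) ℕ.* (B ℕ.* 1)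
            regroup′ = solve-∀

module Density where

  open import Algebra.Bundles using (CommutativeMonoid)
  open import Data.Bool using (true; false; if_then_else_; _∧_)
  open import Data.Integer using (+_)
  open import Data.Nat as ℕ using (ℕ; zero; suc; NonZero; _∸_; _<?_; s≤s; z≤n)
  import Data.Nat.Properties as ℕP
  open import Data.Nat.Divisibility using (_∣_; _∣?_)
  open import Data.Nat.Primality using (Prime; prime?)
  open import Data.Nat.Tactic.RingSolver using (solve-∀)
  open import Data.Rational using (ℚ; _/_; _+_; _*_; _-_; _<_; _≤_; ∣_∣; 0ℚ; 1ℚ)
  import Data.Rational.Properties as ℚP
  open import Relation.Binary.PropositionalEquality
  open import Relation.Nullary using (Dec; does; yes; no)
  open import Relation.Nullary.Decidable using (_×-dec_)
  open import Algebra.Properties.Group ℚP.+-0-group using (quasigroup)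
  open import Algebra.Properties.Quasigroup quasigroup using (x≈z//y)
  open import Algebra.Properties.CommutativeSemigroup
    (CommutativeMonoid.commutativeSemigroup ℚP.*-1-commutativeMonoid) using (interchange)
  open import Data.Product using (∃-syntax; _×_; _,_)
  open import Defs using (cPartial; prod₁; prod₂; factor₁; factor₂; sqfreeCount; squareFree?)
  open EulerProduct
  open Fraction
  open Counting using (count; indicator)
  open Sieve

  module _ (m : ℕ) where

    private
      p = suc (suc m)
      instance
        pp-nonZero : NonZero (p ℕ.* p)
        pp-nonZero = _
      4≤pp : 4 ℕ.≤ p ℕ.* p
      4≤pp = ℕP.*-mono-≤ {2} {p} {2} {p} (s≤s (s≤s z≤n)) (s≤s (s≤s z≤n))

    factor₁≡ : factor₁ p ≡ + (p ℕ.* p ∸ 2) / (p ℕ.* p)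
    factor₁≡ = sym (x≈z//y (+ (p ℕ.* p ∸ 2) / (p ℕ.* p)) (+ 2 / (p ℕ.* p)) 1ℚ (trans
      (/-+-/ (p ℕ.* p ∸ 2) (p ℕ.* p) 2 (p ℕ.* p))
      (/-cong ((p ℕ.* p ∸ 2) ℕ.* (p ℕ.* p) ℕ.+ 2 ℕ.* (p ℕ.* p)) (p ℕ.* p ℕ.* (p ℕ.* p)) 1 1 {{ℕP.m*n≢0 (p ℕ.* p) (p ℕ.* p)}} (trans (ℕP.*-identityʳ _) (trans
        (sym (ℕP.*-distribʳ-+ (p ℕ.* p) (p ℕ.* p ∸ 2) 2))
        (trans (cong (ℕ._* (p ℕ.* p)) (ℕP.m∸n+n≡m {p ℕ.* p} {2} (ℕP.≤-trans (ℕP.n≤1+n 2 ) (ℕP.≤-trans (ℕP.n≤1+n 3) 4≤pp)))) (sym (ℕP.*-identityˡ _))))))))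

    factor₁*factor₂≡ : factor₁ p * factor₂ p ≡ + (p ℕ.* p ∸ 1) / (p ℕ.* p)
    factor₁*factor₂≡ = begin
      factor₁ p * factor₂ p                                     ≡⟨ cong (_* factor₂ p) factor₁≡ ⟩
      (+ (p ℕ.* p ∸ 2) / (p ℕ.* p)) * (+ (p ℕ.* p ∸ 1) / D)     ≡⟨ /-*-/ (p ℕ.* p ∸ 2) (p ℕ.* p) (p ℕ.* p ∸ 1) D ⟩
      (+ ((p ℕ.* p ∸ 2) ℕ.* (p ℕ.* p ∸ 1)) / (p ℕ.* p ℕ.* D)) {{ℕP.m*n≢0 (p ℕ.* p) D}}
                                                                ≡⟨ /-cong ((p ℕ.* p ∸ 2) ℕ.* (p ℕ.* p ∸ 1)) (p ℕ.* p ℕ.* D) (p ℕ.* p ∸ 1) (p ℕ.* p) {{ℕP.m*n≢0 (p ℕ.* p) D}} cross ⟩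
      + (p ℕ.* p ∸ 1) / (p ℕ.* p)                               ∎
      where
      open ≡-Reasoning
      D = suc ((m ℕ.+ 2) ℕ.* (m ℕ.+ 2) ∸ 3)
      D≡pp∸2 : D ≡ p ℕ.* p ∸ 2
      D≡pp∸2 = trans (cong (λ x → suc (x ∸ 3)) (square m)) (sym (ℕP.+-∸-assoc 1 {p ℕ.* p} {3} (ℕP.≤-trans (ℕP.n≤1+n 3) 4≤pp)))
        where square : ∀ m → (m ℕ.+ 2) ℕ.* (m ℕ.+ 2) ≡ suc (suc m) ℕ.* suc (suc m)
              square = solve-∀
      cross : (p ℕ.* p ∸ 2) ℕ.* (p ℕ.* p ∸ 1) ℕ.* (p ℕ.* p) ≡ (p ℕ.* p ∸ 1) ℕ.* (p ℕ.* p ℕ.* D)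
      cross = trans (regroup (p ℕ.* p ∸ 2) (p ℕ.* p ∸ 1) (p ℕ.* p)) (cong (λ x → (p ℕ.* p ∸ 1) ℕ.* (p ℕ.* p ℕ.* x)) (sym D≡pp∸2))
        where regroup : ∀ a b c → a ℕ.* b ℕ.* c ≡ b ℕ.* (c ℕ.* a)
              regroup = solve-∀

  private
    localFactor : ℕ → ℕ → ℕ → ℚ
    localFactor k ℓ p = (if does (prime? p) then factor₁ p else 1ℚ)
                      * (if does (prime? p ×-dec (2 <? p) ×-dec (p ∣? k ℕ.* ℓ)) then factor₂ p else 1ℚ)

    if-nonZero : ∀ Q q {{_ : NonZero Q}} .{{_ : NonZero q}} b → NonZero (if b then Q ℕ.* q else Q)
    if-nonZero Q q true  = ℕP.m*n≢0 Q q
    if-nonZero Q q {{Q≢0}} false = Q≢0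

  cPartial-suc : ∀ k ℓ P → cPartial k ℓ (suc P) ≡ cPartial k ℓ P * localFactor k ℓ (suc P)
  cPartial-suc k ℓ P = trans (cong (_* (prod₂ k ℓ P * y)) (sym (ℚP.*-assoc (+ 2 / 1) (prod₁ P) x)))
                             (interchange (+ 2 / 1 * prod₁ P) x (prod₂ k ℓ P) y)
    where x = if does (prime? (suc P)) then factor₁ (suc P) else 1ℚ
          y = if does (prime? (suc P) ×-dec (2 <? suc P) ×-dec (suc P ∣? k ℕ.* ℓ)) then factor₂ (suc P) else 1ℚ

  module _ (k ℓ m U Q : ℕ) {{_ : NonZero Q}} where

    private
      p = suc (suc (suc m))
      instance
        pp-nonZero : NonZero (p ℕ.* p)
        pp-nonZero = _

    localFactor-step : (p-prime? : Dec (Prime p)) (p∣kℓ? : Dec (p ∣ k ℕ.* ℓ)) →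
      (+ U / Q) * ((if does p-prime? then factor₁ p else 1ℚ) * (if does p-prime? ∧ does p∣kℓ? then factor₂ p else 1ℚ))
      ≡ (+ (if does p-prime? then U ℕ.* (p ℕ.* p ∸ (if does p∣kℓ? then 1 else 2)) else U)
          / (if does p-prime? then Q ℕ.* (p ℕ.* p) else Q)) {{if-nonZero Q (p ℕ.* p) (does p-prime?)}}
    localFactor-step (no _)  _       = trans (cong ((+ U / Q) *_) (ℚP.*-identityʳ 1ℚ)) (ℚP.*-identityʳ _)
    localFactor-step (yes _) (yes _) = trans (cong ((+ U / Q) *_) (factor₁*factor₂≡ (suc m))) (/-*-/ U Q (p ℕ.* p ∸ 1) (p ℕ.* p))
    localFactor-step (yes _) (no _)  = trans (cong ((+ U / Q) *_) (trans (ℚP.*-identityʳ _) (factor₁≡ (suc m))))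
                                             (/-*-/ U Q (p ℕ.* p ∸ 2) (p ℕ.* p))

  cPartial[2+d]≡unsieved/primorial² : ∀ k ℓ d → let P = 2 ℕ.+ d in
    cPartial k ℓ P ≡ (+ unsieved (ρ k ℓ) P / primorial² P) {{primorial²-nonZero P}}
  cPartial[2+d]≡unsieved/primorial² k ℓ zero    = refl
  cPartial[2+d]≡unsieved/primorial² k ℓ (suc d) = begin
    cPartial k ℓ (3 ℕ.+ d)                                    ≡⟨ cPartial-suc k ℓ (2 ℕ.+ d) ⟩
    cPartial k ℓ (2 ℕ.+ d) * localFactor k ℓ (3 ℕ.+ d)        ≡⟨ cong (_* localFactor k ℓ (3 ℕ.+ d)) (cPartial[2+d]≡unsieved/primorial² k ℓ d) ⟩
    (+ U / Q) * localFactor k ℓ (3 ℕ.+ d)                     ≡⟨ localFactor-step k ℓ d U Q (prime? (3 ℕ.+ d)) ((3 ℕ.+ d) ∣? k ℕ.* ℓ) ⟩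
    (+ unsieved (ρ k ℓ) (3 ℕ.+ d) / primorial² (3 ℕ.+ d)) {{primorial²-nonZero (3 ℕ.+ d)}} ∎
    where
    open ≡-Reasoning
    U = unsieved (ρ k ℓ) (2 ℕ.+ d)
    Q = primorial² (2 ℕ.+ d)
    instance
      Q-nonZero = primorial²-nonZero (2 ℕ.+ d)

  cPartial≡unsieved/primorial² : ∀ k ℓ P → 2 ℕ.≤ P → cPartial k ℓ P ≡ (+ unsieved (ρ k ℓ) P / primorial² P) {{primorial²-nonZero P}}
  cPartial≡unsieved/primorial² k ℓ P 2≤P = subst (λ P → cPartial k ℓ P ≡ (+ unsieved (ρ k ℓ) P / primorial² P) {{primorial²-nonZero P}})
    (ℕP.m+[n∸m]≡n 2≤P) (cPartial[2+d]≡unsieved/primorial² k ℓ (P ∸ 2))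

  sqfreeCount≡count : ∀ f N → sqfreeCount f N ≡ count (λ n → does (squareFree? (f (suc n)))) N
  sqfreeCount≡count f zero    = refl
  sqfreeCount≡count f (suc N) = cong₂ ℕ._+_ (sqfreeCount≡count f N) (if≡indicator (does (squareFree? (f (suc N)))))
    where if≡indicator : ∀ b → (if b then 1 else 0) ≡ indicator b
          if≡indicator true  = refl
          if≡indicator false = refl

  squarefree-asymptotic : ∀ {k ℓ f} → LinearFactorisation k ℓ f → (ε : ℚ) → 0ℚ < ε →
    ∃[ N₀ ] ∃[ P₀ ] ((N P : ℕ) → N₀ ℕ.≤ N → P₀ ℕ.≤ P →
      ∣ (+ sqfreeCount f N / 1) - cPartial k ℓ P * (+ N / 1) ∣ < ε * (+ N / 1))
  squarefree-asymptotic {k} {ℓ} {f} L ε 0<ε with positive⇒/ ε 0<ε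
  ... | u , m′ , refl = threshold L m′ , z , close
    where
    z = suc (8 ℕ.* suc m′)
    close : ∀ N P → threshold L m′ ℕ.≤ N → z ℕ.≤ P →
      ∣ (+ sqfreeCount f N / 1) - cPartial k ℓ P * (+ N / 1) ∣ < (+ suc u / suc m′) * (+ N / 1)
    close N P threshold≤N z≤P = subst₂ (λ C x → ∣ (+ C / 1) - x * (+ N / 1) ∣ < (+ suc u / suc m′) * (+ N / 1))
      (sym (sqfreeCount≡count f N)) (sym (cPartial≡unsieved/primorial² k ℓ P (ℕP.≤-trans (s≤s (s≤s z≤n)) z≤P)))
      (∣-∣<-cross (count (squarefree L) N) N (unsieved (ρ k ℓ) P) (primorial² P) u m′ {{primorial²-nonZero P}}
        (density-upper L m′ N P threshold≤N z≤P) (density-lower L m′ N P threshold≤N z≤P))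

  cPartial-lower-bound : ∀ k ℓ → ∃[ δ ] (0ℚ < δ × ∃[ P₀ ] ((P : ℕ) → P₀ ℕ.≤ P → (+ 16 / 25) + δ ≤ cPartial k ℓ P))
  cPartial-lower-bound k ℓ = + 1 / 1000 , /-mono-< 0 1 1 1000 (s≤s z≤n) , 300 , bound
    where
    bound : ∀ P → 300 ℕ.≤ P → (+ 16 / 25) + (+ 1 / 1000) ≤ cPartial k ℓ P
    bound P 300≤P = subst₂ _≤_ (sym (/-+-/ 16 25 1 1000)) (sym (cPartial≡unsieved/primorial² k ℓ P (ℕP.≤-trans (s≤s (s≤s z≤n)) 300≤P)))
      (/-mono-≤ 16025 25000 U Q {{_}} {{primorial²-nonZero P}} (begin
        16025 ℕ.* Q      ≡⟨ scale Q ⟩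
        25 ℕ.* (641 ℕ.* Q) ≤⟨ ℕP.*-monoʳ-≤ 25 (unsieved-lower-bound k ℓ P 300≤P) ⟩
        25 ℕ.* (1000 ℕ.* U) ≡⟨ scale′ U ⟩
        U ℕ.* 25000      ∎))
      where
      open ℕP.≤-Reasoning
      U = unsieved (ρ k ℓ) P
      Q = primorial² P
      scale : ∀ Q → 16025 ℕ.* Q ≡ 25 ℕ.* (641 ℕ.* Q)
      scale = solve-∀
      scale′ : ∀ U → 25 ℕ.* (1000 ℕ.* U) ≡ U ℕ.* 25000
      scale′ = solve-∀

module Reduction where

  open import Data.Empty using (⊥-elim)
  open import Data.Nat
  open import Data.Nat.DivMod using (m*n/n≡m)
  open import Data.Nat.Divisibility
  open import Data.Nat.GCD using (gcd)
  open import Data.Nat.Primality using (Prime)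
  open import Data.Nat.Properties
  open import Data.Nat.Tactic.RingSolver using (solve-∀)
  open import Data.Product using (Σ; _×_; _,_; proj₁; proj₂)
  open import Data.Sum using (_⊎_; inj₁; inj₂)
  open import Function.Bundles using (_⇔_)
  import Function.Properties.Equivalence as ⇔
  import Data.Sum
  open import Relation.Binary.PropositionalEquality
  open import Relation.Nullary using (¬_; yes; no)
  open import Defs using (Odd; TypeA; TypeB; odd-same; odd-diff; even-quarter; even-three-quarter)
  open Divisibility
  open Sieve using (LinearFactorisation)

  shifted-resultant : ∀ c e g K L u v → (K * u ≡ L * v + 1) ⊎ (L * v ≡ K * u + 1) →
    (c * L * (g * v + e * K) ≡ c * K * (g * u + e * L) + c * g) ⊎
    (c * K * (g * u + e * L) ≡ c * L * (g * v + e * K) + c * g)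
  shifted-resultant c e g K L u v (inj₁ Ku≡Lv+1) = inj₂ (begin
    c * K * (g * u + e * L)           ≡⟨ expand c e g K L u ⟩
    c * g * (K * u) + c * e * K * L   ≡⟨ cong (λ t → c * g * t + c * e * K * L) Ku≡Lv+1 ⟩
    c * g * (L * v + 1) + c * e * K * L ≡⟨ collect c e g K L v ⟩
    c * L * (g * v + e * K) + c * g   ∎)
    where
    open ≡-Reasoning
    expand : ∀ c e g K L u → c * K * (g * u + e * L) ≡ c * g * (K * u) + c * e * K * L
    expand = solve-∀
    collect : ∀ c e g K L v → c * g * (L * v + 1) + c * e * K * L ≡ c * L * (g * v + e * K) + c * g
    collect = solve-∀
  shifted-resultant c e g K L u v (inj₂ Lv≡Ku+1) = inj₁ (begin
    c * L * (g * v + e * K)           ≡⟨ expand c e g L K v ⟩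
    c * g * (L * v) + c * e * L * K   ≡⟨ cong (λ t → c * g * t + c * e * L * K) Lv≡Ku+1 ⟩
    c * g * (K * u + 1) + c * e * L * K ≡⟨ collect c e g L K u ⟩
    c * K * (g * u + e * L) + c * g   ∎)
    where
    open ≡-Reasoning
    expand : ∀ c e g K L u → c * K * (g * u + e * L) ≡ c * g * (K * u) + c * e * K * L
    expand = solve-∀
    collect : ∀ c e g K L v → c * g * (L * v + 1) + c * e * K * L ≡ c * L * (g * v + e * K) + c * g
    collect = solve-∀

  -- Both types have f (n + 1) = (c x² n + g v + e x²) (c y² n + g u + e y²) with c and c g powers of 2.
  fromShape : ∀ {k ℓ f} x y u v i e g j → let c = 2 ^ i; K = x * x; L = y * y in
    (∀ n → f (suc n) ≡ (c * K * n + (g * v + e * K)) * (c * L * n + (g * u + e * L))) →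
    (∀ n → ¬ (2 * 2 ∣ f (suc n))) → c * g ≡ 2 ^ j → (K * u ≡ L * v + 1) ⊎ (L * v ≡ K * u + 1) →
    (∀ p → Prime p → p ≢ 2 → p ∣ x ⇔ p ∣ k) → (∀ p → Prime p → p ≢ 2 → p ∣ y ⇔ p ∣ ℓ) →
    gcd k ℓ ≡ 1 ⊎ gcd k ℓ ≡ 2 → LinearFactorisation k ℓ f
  fromShape {k} {ℓ} x y u v i e g j split 4∤f cg≡2^j bezout x∼k y∼ℓ gcd≡ = record
    { a₁ = 2 ^ i * (x * x) ; b₁ = g * v + e * (x * x)
    ; a₂ = 2 ^ i * (y * y) ; b₂ = g * u + e * (y * y)
    ; w  = 2 ^ i * g
    ; f-split     = split
    ; 4∤f         = 4∤f
    ; resultant   = shifted-resultant (2 ^ i) e g (x * x) (y * y) u v bezout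
    ; odd-prime∤w = λ p p-prime p≢2 p∣cg → odd-prime∤2^ p-prime p≢2 j (subst (p ∣_) cg≡2^j p∣cg)
    ; a₁∼k        = λ p p-prime p≢2 → leading x k p p-prime p≢2 (x∼k p p-prime p≢2)
    ; a₂∼ℓ        = λ p p-prime p≢2 → leading y ℓ p p-prime p≢2 (y∼ℓ p p-prime p≢2)
    ; k⊥ℓ         = gcd∈1,2⇒no-common-odd-prime gcd≡
    }
    where
    leading : ∀ x k p → Prime p → p ≢ 2 → p ∣ x ⇔ p ∣ k → p ∣ 2 ^ i * (x * x) ⇔ p ∣ k
    leading x k p p-prime p≢2 x∼k = ⇔.trans (odd-prime∣2^*⇔ p-prime p≢2 i (x * x)) (⇔.trans (prime∣square⇔ p-prime) x∼k)

  typeA⇒linearFactorisation : ∀ {k ℓ f} → TypeA k ℓ f → LinearFactorisation k ℓ f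
  typeA⇒linearFactorisation {k} {ℓ} {f} A = fromShape k ℓ u v 1 3 g (proj₁ 2g≡2^j) split 4∤f (proj₂ 2g≡2^j) bezout
    (λ _ _ _ → ⇔.refl) (λ _ _ _ → ⇔.refl) (inj₁ coprime)
    where
    open TypeA A
    2g≡2^j : Σ ℕ λ j → 2 * g ≡ 2 ^ j
    2g≡2^j with g-cases
    ... | inj₁ refl       = 2 , refl
    ... | inj₂ (refl , _) = 3 , refl
    2∣g : 2 ∣ g
    2∣g with g-cases
    ... | inj₁ refl       = divides 1 refl
    ... | inj₂ (refl , _) = divides 2 refl
    shift : ∀ k n g v → k * k * (1 + 2 * suc n) + g * v ≡ 2 * (k * k) * n + (g * v + 3 * (k * k))
    shift = solve-∀
    split : ∀ n → f (suc n) ≡ (2 * (k * k) * n + (g * v + 3 * (k * k))) * (2 * (ℓ * ℓ) * n + (g * u + 3 * (ℓ * ℓ)))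
    split n = trans (f-def (suc n)) (cong₂ _*_ (shift k n g v) (shift ℓ n g u))
    odd-square-term : ∀ {x} → Odd x → ∀ m → Odd (x * x * (1 + 2 * m))
    odd-square-term odd-x m = odd-* (odd-* odd-x odd-x) (odd-1+2m m)
    odd-u-if-ℓ-even : 2 ∣ ℓ → Odd u
    odd-u-if-ℓ-even 2∣ℓ 2∣u with bezout
    ... | inj₁ kku≡ℓℓv+1 = ¬2∣1 (∣m+n∣m⇒∣n (subst (2 ∣_) kku≡ℓℓv+1 (∣n⇒∣m*n (k * k) 2∣u)) (even-* v (even-* ℓ 2∣ℓ)))
    ... | inj₂ ℓℓv≡kku+1 = ¬2∣1 (∣m+n∣m⇒∣n (subst (2 ∣_) ℓℓv≡kku+1 (even-* v (even-* ℓ 2∣ℓ))) (∣n⇒∣m*n (k * k) 2∣u))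
    -- The first factor is odd; the second is odd, or twice an odd number when ℓ is even.
    4∤f : ∀ n → ¬ (2 * 2 ∣ f (suc n))
    4∤f n 4∣f with 2 ∣? ℓ
    ... | no odd-ℓ = odd*odd-¬4∣ odd-X (odd+even (odd-square-term odd-ℓ (suc n)) (∣m⇒∣m*n u 2∣g)) (subst (2 * 2 ∣_) (f-def (suc n)) 4∣f)
      where odd-X = odd+even (odd-square-term k-odd (suc n)) (∣m⇒∣m*n v 2∣g)
    ... | yes (divides ℓ₀ ℓ≡ℓ₀2) with g-cases
    ...   | inj₂ (_ , odd-ℓ) = odd-ℓ (divides ℓ₀ ℓ≡ℓ₀2)
    ...   | inj₁ g≡2 = odd*even-¬4∣ odd-X odd-Y (subst (2 * 2 ∣_) f≡X2Y 4∣f)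
      where
      m = suc n
      X = k * k * (1 + 2 * m) + g * v
      Y = 2 * (ℓ₀ * ℓ₀ * (1 + 2 * m)) + u
      odd-X = odd+even (odd-square-term k-odd m) (∣m⇒∣m*n v 2∣g)
      odd-Y : Odd Y
      odd-Y = even+odd (divides (ℓ₀ * ℓ₀ * (1 + 2 * m)) (*-comm 2 (ℓ₀ * ℓ₀ * (1 + 2 * m)))) (odd-u-if-ℓ-even (divides ℓ₀ ℓ≡ℓ₀2))
      halve : ∀ ℓ₀ m u → ℓ₀ * 2 * (ℓ₀ * 2) * (1 + 2 * m) + 2 * u ≡ 2 * (2 * (ℓ₀ * ℓ₀ * (1 + 2 * m)) + u)
      halve = solve-∀
      f≡X2Y : f (suc n) ≡ X * (2 * Y)
      f≡X2Y = trans (f-def (suc n)) (cong (X *_) (trans (cong₂ (λ a b → a * a * (1 + 2 * m) + b * u) ℓ≡ℓ₀2 g≡2) (halve ℓ₀ m u)))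

  bezout-parity : ∀ {A B x y} → (A * x ≡ B * y + 1) ⊎ (B * y ≡ A * x + 1) → 2 ∣ x → Odd (B * y)
  bezout-parity {A} (inj₁ Ax≡By+1) 2∣x 2∣By = ¬2∣1 (∣m+n∣m⇒∣n (subst (2 ∣_) Ax≡By+1 (∣n⇒∣m*n A 2∣x)) 2∣By)
  bezout-parity {A} (inj₂ By≡Ax+1) 2∣x 2∣By = ¬2∣1 (∣m+n∣m⇒∣n (subst (2 ∣_) By≡Ax+1 2∣By) (∣n⇒∣m*n A 2∣x))

  module _ (K₀ : ℕ) {K : ℕ} (K≡K₀2 : K ≡ K₀ * 2) where

    square-halve : K * K ≡ 4 * (K₀ * K₀)
    square-halve = trans (cong (λ x → x * x) K≡K₀2) (regroup K₀)
      where regroup : ∀ K₀ → K₀ * 2 * (K₀ * 2) ≡ 4 * (K₀ * K₀)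
            regroup = solve-∀

    square*/2 : ∀ t → K * K * t / 2 ≡ K₀ * K₀ * (2 * t)
    square*/2 t = trans (cong (λ x → x * t / 2) square-halve) (trans (cong (_/ 2) (regroup K₀ t)) (m*n/n≡m (K₀ * K₀ * (2 * t)) 2))
      where regroup : ∀ K₀ t → 4 * (K₀ * K₀) * t ≡ K₀ * K₀ * (2 * t) * 2
            regroup = solve-∀

    square*/4 : ∀ t → K * K * t / 4 ≡ K₀ * K₀ * t
    square*/4 t = trans (cong (λ x → x * t / 4) square-halve) (trans (cong (_/ 4) (regroup K₀ t)) (m*n/n≡m (K₀ * K₀ * t) 4))
      where regroup : ∀ K₀ t → 4 * (K₀ * K₀) * t ≡ K₀ * K₀ * t * 4
            regroup = solve-∀

    halve-odd-prime∣ : ∀ p → Prime p → p ≢ 2 → p ∣ K₀ ⇔ p ∣ K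
    halve-odd-prime∣ p p-prime p≢2 = ⇔.sym (subst (λ x → p ∣ x ⇔ p ∣ K₀) (trans (*-comm 2 K₀) (sym K≡K₀2))
                                                  (odd-prime∣2^*⇔ p-prime p≢2 1 K₀))

    4∣⇒2∣half : 4 ∣ K → 2 ∣ K₀
    4∣⇒2∣half 4∣K = *-cancelʳ-∣ 2 (subst (4 ∣_) K≡K₀2 4∣K)

  cancel-4 : ∀ A B x y → 4 * A * x ≡ 4 * B * y + 4 → A * x ≡ B * y + 1
  cancel-4 A B x y 4Ax≡4By+4 = *-cancelˡ-≡ _ _ 4 (trans (regroup A x) (trans 4Ax≡4By+4 (regroup′ B y)))
    where regroup : ∀ A x → 4 * (A * x) ≡ 4 * A * x
          regroup = solve-∀
          regroup′ : ∀ B y → 4 * B * y + 4 ≡ 4 * (B * y + 1)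
          regroup′ = solve-∀

  -- Halving k and ℓ turns every Type B shape into (v + k₀² T n) (u + ℓ₀² T n) with T n = 2^i n + b.
  module _ {k ℓ f} (B : TypeB k ℓ f) where

    open TypeB B

    private
      k₀ = quotient k-even
      ℓ₀ = quotient ℓ-even
      k≡k₀2 : k ≡ k₀ * 2
      k≡k₀2 = m∣n⇒n≡quotient*m k-even
      ℓ≡ℓ₀2 : ℓ ≡ ℓ₀ * 2
      ℓ≡ℓ₀2 = m∣n⇒n≡quotient*m ℓ-even

      bezout₀ : (k₀ * k₀ * u ≡ ℓ₀ * ℓ₀ * v + 1) ⊎ (ℓ₀ * ℓ₀ * v ≡ k₀ * k₀ * u + 1)
      bezout₀ with bezout
      ... | inj₁ kku≡ℓℓv+4 = inj₁ (cancel-4 (k₀ * k₀) (ℓ₀ * ℓ₀) u v (subst₂ (λ K L → K * u ≡ L * v + 4) (square-halve k₀ k≡k₀2) (square-halve ℓ₀ ℓ≡ℓ₀2) kku≡ℓℓv+4))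
      ... | inj₂ ℓℓv≡kku+4 = inj₂ (cancel-4 (ℓ₀ * ℓ₀) (k₀ * k₀) v u (subst₂ (λ L K → L * v ≡ K * u + 4) (square-halve ℓ₀ ℓ≡ℓ₀2) (square-halve k₀ k≡k₀2) ℓℓv≡kku+4))

      fromHalvedShape : ∀ i b → let T = λ n → 2 ^ i * n + b in
        (∀ n → f n ≡ (v + k₀ * k₀ * T n) * (u + ℓ₀ * ℓ₀ * T n)) →
        (∀ n → Odd (v + k₀ * k₀ * T n) × Odd (u + ℓ₀ * ℓ₀ * T n)) → LinearFactorisation k ℓ f
      fromHalvedShape i b shape odd = fromShape k₀ ℓ₀ u v i (2 ^ i + b) 1 i split 4∤f (*-identityʳ (2 ^ i)) bezout₀
        (halve-odd-prime∣ k₀ k≡k₀2) (halve-odd-prime∣ ℓ₀ ℓ≡ℓ₀2) (inj₂ gcd≡2)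
        where
        shift : ∀ c b v K n → v + K * (c * suc n + b) ≡ c * K * n + (1 * v + (c + b) * K)
        shift = solve-∀
        split : ∀ n → f (suc n) ≡ (2 ^ i * (k₀ * k₀) * n + (1 * v + (2 ^ i + b) * (k₀ * k₀)))
                                * (2 ^ i * (ℓ₀ * ℓ₀) * n + (1 * u + (2 ^ i + b) * (ℓ₀ * ℓ₀)))
        split n = trans (shape (suc n)) (cong₂ _*_ (shift (2 ^ i) b v (k₀ * k₀) n) (shift (2 ^ i) b u (ℓ₀ * ℓ₀) n))
        4∤f : ∀ n → ¬ (2 * 2 ∣ f (suc n))
        4∤f n 4∣f = odd*odd-¬4∣ (proj₁ (odd (suc n))) (proj₂ (odd (suc n))) (subst (2 * 2 ∣_) (shape (suc n)) 4∣f)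

      odd+even-term : ∀ {x} K t → Odd x → 2 ∣ t → Odd (x + K * t)
      odd+even-term K t odd-x 2∣t = odd+even odd-x (∣n⇒∣m*n K 2∣t)

      -- If u is even then v and ℓ₀ are odd (by the halved Bezout identity) and k₀ is even (4 divides k or ℓ).
      quarter-parity : ∀ {c} → Odd c → 2 ∣ u ⊎ 2 ∣ v → ∀ n →
        Odd (v + k₀ * k₀ * (4 * n + c)) × Odd (u + ℓ₀ * ℓ₀ * (4 * n + c))
      quarter-parity {c} odd-c (inj₁ 2∣u) n = odd+even odd-v (even-* (4 * n + c) (even-* k₀ 2∣k₀))
                                        , even+odd 2∣u (odd-* (odd-* odd-ℓ₀ odd-ℓ₀) (odd-4m+c n odd-c))
        where
        odd-ℓ₀ℓ₀v : Odd (ℓ₀ * ℓ₀ * v)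
        odd-ℓ₀ℓ₀v = bezout-parity {k₀ * k₀} {ℓ₀ * ℓ₀} {u} {v} bezout₀ 2∣u
        odd-ℓ₀ : Odd ℓ₀
        odd-ℓ₀ 2∣ℓ₀ = odd-ℓ₀ℓ₀v (even-* v (even-* ℓ₀ 2∣ℓ₀))
        odd-v : Odd v
        odd-v 2∣v = odd-ℓ₀ℓ₀v (∣n⇒∣m*n (ℓ₀ * ℓ₀) 2∣v)
        2∣k₀ : 2 ∣ k₀
        2∣k₀ with one-by-4
        ... | inj₁ (4∣k , _) = 4∣⇒2∣half k₀ k≡k₀2 4∣k
        ... | inj₂ (_ , 4∣ℓ) = ⊥-elim (odd-ℓ₀ (4∣⇒2∣half ℓ₀ ℓ≡ℓ₀2 4∣ℓ))
      quarter-parity {c} odd-c (inj₂ 2∣v) n = even+odd 2∣v (odd-* (odd-* odd-k₀ odd-k₀) (odd-4m+c n odd-c))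
                                        , odd+even odd-u (even-* (4 * n + c) (even-* ℓ₀ 2∣ℓ₀))
        where
        odd-k₀k₀u : Odd (k₀ * k₀ * u)
        odd-k₀k₀u = bezout-parity {ℓ₀ * ℓ₀} {k₀ * k₀} {v} {u} (Data.Sum.swap bezout₀) 2∣v
        odd-k₀ : Odd k₀
        odd-k₀ 2∣k₀ = odd-k₀k₀u (even-* u (even-* k₀ 2∣k₀))
        odd-u : Odd u
        odd-u 2∣u = odd-k₀k₀u (∣n⇒∣m*n (k₀ * k₀) 2∣u)
        2∣ℓ₀ : 2 ∣ ℓ₀
        2∣ℓ₀ with one-by-4
        ... | inj₁ (4∣k , _) = ⊥-elim (odd-k₀ (4∣⇒2∣half k₀ k≡k₀2 4∣k))
        ... | inj₂ (_ , 4∣ℓ) = 4∣⇒2∣half ℓ₀ ℓ≡ℓ₀2 4∣ℓ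

      even-u∨even-v : ∀ {X Y : Set} → (2 ∣ u × X) ⊎ (2 ∣ v × Y) → 2 ∣ u ⊎ 2 ∣ v
      even-u∨even-v = Data.Sum.map proj₁ proj₁

      2∣8n+b : ∀ n {b} → 2 ∣ b → 2 ∣ 8 * n + b
      2∣8n+b n 2∣b = ∣m∣n⇒∣m+n (∣m⇒∣m*n n (divides 4 refl)) 2∣b

      shape-from : ∀ {X Y T : ℕ → ℕ} → (∀ n → f n ≡ (v + X n) * (u + Y n)) →
        (∀ n → X n ≡ k₀ * k₀ * T n) → (∀ n → Y n ≡ ℓ₀ * ℓ₀ * T n) →
        ∀ n → f n ≡ (v + k₀ * k₀ * T n) * (u + ℓ₀ * ℓ₀ * T n)
      shape-from f-def F≡ G≡ n = trans (f-def n) (cong₂ _*_ (cong (v +_) (F≡ n)) (cong (u +_) (G≡ n)))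

    typeB⇒linearFactorisation : LinearFactorisation k ℓ f
    typeB⇒linearFactorisation with f-shape
    ... | odd-same odd-u odd-v _ f-def = fromHalvedShape 3 4 (shape-from f-def (same k₀ k≡k₀2) (same ℓ₀ ℓ≡ℓ₀2))
            (λ n → odd+even-term (k₀ * k₀) _ odd-v (2∣8n+b n (divides 2 refl)) , odd+even-term (ℓ₀ * ℓ₀) _ odd-u (2∣8n+b n (divides 2 refl)))
      where
      same : ∀ K₀ {K} → K ≡ K₀ * 2 → ∀ n → K * K * (2 * n + 1) ≡ K₀ * K₀ * (8 * n + 4)
      same K₀ K≡K₀2 n = trans (cong (_* (2 * n + 1)) (square-halve K₀ K≡K₀2)) (regroup K₀ n)
        where regroup : ∀ K₀ n → 4 * (K₀ * K₀) * (2 * n + 1) ≡ K₀ * K₀ * (8 * n + 4)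
              regroup = solve-∀
    ... | odd-diff odd-u odd-v _ f-def = fromHalvedShape 3 2 (shape-from f-def (diff k₀ k≡k₀2) (diff ℓ₀ ℓ≡ℓ₀2))
            (λ n → odd+even-term (k₀ * k₀) _ odd-v (2∣8n+b n (divides 1 refl)) , odd+even-term (ℓ₀ * ℓ₀) _ odd-u (2∣8n+b n (divides 1 refl)))
      where
      diff : ∀ K₀ {K} → K ≡ K₀ * 2 → ∀ n → K * K * (4 * n + 1) / 2 ≡ K₀ * K₀ * (8 * n + 2)
      diff K₀ K≡K₀2 n = trans (square*/2 K₀ K≡K₀2 (4 * n + 1)) (cong (K₀ * K₀ *_) (double n))
        where double : ∀ n → 2 * (4 * n + 1) ≡ 8 * n + 2
              double = solve-∀
    ... | even-quarter _ _ u-or-v-even _ f-def = fromHalvedShape 2 1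
            (shape-from f-def (λ n → square*/4 k₀ k≡k₀2 (4 * n + 1)) (λ n → square*/4 ℓ₀ ℓ≡ℓ₀2 (4 * n + 1)))
            (quarter-parity ¬2∣1 (even-u∨even-v u-or-v-even))
    ... | even-three-quarter _ _ u-or-v-even _ f-def = fromHalvedShape 2 3
            (shape-from f-def (λ n → square*/4 k₀ k≡k₀2 (4 * n + 3)) (λ n → square*/4 ℓ₀ ℓ≡ℓ₀2 (4 * n + 3)))
            (quarter-parity (odd+even ¬2∣1 (divides 1 refl)) (even-u∨even-v u-or-v-even))

open import Defs
open import Data.Nat using (ℕ) renaming (_≤_ to _≤ℕ_)
open import Data.Integer using (+_)
open import Data.Rational using (ℚ; _<_; _≤_; _+_; _-_; _*_; _/_; ∣_∣; 0ℚ)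
open import Data.Product using (_×_; ∃-syntax; _,_)
open import Data.Sum using (_⊎_; inj₁; inj₂)
open Sieve using (LinearFactorisation)
open Reduction using (typeA⇒linearFactorisation; typeB⇒linearFactorisation)
open Density using (squarefree-asymptotic; cPartial-lower-bound)

linearFactorisation : ∀ {k ℓ f} → TypeA k ℓ f ⊎ TypeB k ℓ f → LinearFactorisation k ℓ f
linearFactorisation (inj₁ A) = typeA⇒linearFactorisation A
linearFactorisation (inj₂ B) = typeB⇒linearFactorisation B

proposition6p6 : (k ℓ : ℕ) (f : ℕ → ℕ) → TypeA k ℓ f ⊎ TypeB k ℓ f →
    -- #{1 ≤ n ≤ N : f n squarefree} ~ c_f N, with c_f the limit of cPartial k ℓ P
    ((ε : ℚ) → 0ℚ < ε → ∃[ N₀ ] ∃[ P₀ ] ((N P : ℕ) → N₀ ≤ℕ N → P₀ ≤ℕ P →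
        ∣ (+ sqfreeCount f N / 1) - cPartial k ℓ P * (+ N / 1) ∣ < ε * (+ N / 1)))
    -- and c_f > 0.64
    × (∃[ δ ] (0ℚ < δ × ∃[ P₀ ] ((P : ℕ) → P₀ ≤ℕ P → (+ 16 / 25) + δ ≤ cPartial k ℓ P)))
proposition6p6 k ℓ f typeAorB = squarefree-asymptotic (linearFactorisation typeAorB) , cPartial-lower-bound k ℓ
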